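{- Let $t$ be a first-order term. Then the partially ordered set of geometric clusters for $t$ ordered by $\subseteq$ is order-isomorphic to the set of inductive clusters for $t$, taken up to renaming of gaps, ordered by the coarsening order $\sqsubseteq$. Moreover, this order is a finite distributive lattice.
   Context: Terms are finite first-order terms over a signature of function symbols with fixed arities and first-order variables $x_1,x_2,\dots$. Geometric side. A position is a finite sequence of positive natural numbers, followed by a marker saying whether it is a vertex position or an edge position; write $p\cdot\mathsf v$ / $p\cdot\mathsf e$ for the vertex/edge position at sequence $p$, $\varepsilon$ for the empty sequence, and $i\cdot P=\{i\cdot q\mid q\in P\}$ for prefixing. The Tree interpretation of a term assigns to $f(t_1,\dots,t_n)$ the set $\{\varepsilon\cdot\mathsf e,\varepsilon\cdot\mathsf v\}\cup\bigcup_i i\cdot P_i$ where $P_i$ is the set assigned to $t_i$. The internal positions of $t$ are obtained by interpreting variables as $\emptyset$ and removing the root edge $\varepsilon\cdot\mathsf e$. The edge position $p\cdot i\cdot\mathsf e$ has endpoints $p\cdot\mathsf v$ and $p\cdot i\cdot\mathsf v$. A geometric cluster for $t$ is a set of internal positions of $t$ that contains both endpoints of each edge position it contains. Inductive side. A skeleton is a term built from function symbols, first-order variables, and second-order variables called gaps (each gap has an arity $n$ and is applied to $n$ arguments). A pattern-skeleton of arity $n$ is a skeleton that is not a first-order variable and is standard: the sequence of first-order variable occurrences read from left to right is exactly $x_1,\dots,x_n$. A pattern is a pattern-skeleton without gaps. An inductive cluster is a pair $(M,[\vec Z:=\vec\ell])$ where $M$ is a skeleton in which each gap occurs at most once, and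 $[\vec Z:=\vec \ell]$ assigns to each gap $Z_j$ of $M$ a pattern $\ell_j$ of the same arity as $Z_j$. Applying such a second-order substitution replaces each occurrence $Z_j(s_1,\dots,s_n)$ by $\ell_j$ with $x_k$ replaced by $s_k$. It is an inductive cluster for the term $M[\vec Z:=\vec\ell]$ (the result of this substitution). The refinement order $\sqsupseteq$ is defined by $(N,\beta)\sqsupseteq(M,\alpha)$ iff there is a substitution $\gamma$ mapping each gap of $N$ to a pattern-skeleton of the same arity such that $\gamma(N)=M$ and $\beta(Z)=\alpha(\gamma(Z))$ for every gap $Z$ of $N$; the coarsening order $\sqsubseteq$ is its converse. (For example, $(Z',[Z':=f(a)])\sqsupseteq(Z(Y),[Z:=f(x_1),Y:=a])$ via $\gamma=[Z':=Z(Y)]$.) -}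

module Defs where

open import Level using (0ℓ)
open import Data.Nat using (ℕ; zero; suc)
open import Data.Fin using (Fin; toℕ)
open import Data.Vec using (Vec; []; _∷_; lookup)
open import Data.List using (List; []; _∷_; _++_; [_]; upTo)
open import Data.List.Membership.Propositional using (_∈_)
open import Data.List.Relation.Unary.Any using (Any)
open import Data.List.Relation.Unary.Unique.Propositional using (Unique)
open import Data.Product using (Σ; _×_; _,_; proj₁; proj₂)
open import Data.Bool using (Bool; true)
open import Data.Empty using (⊥)
open import Data.Unit using (⊤)
open import Relation.Nullary using (¬_)
open import Relation.Binary.Core using (Rel)
open import Relation.Binary.PropositionalEquality using (_≡_; _≢_)
open import Function.Bundles using (_⇔_)

-- Positions: a finite sequence of positive naturals plus a marker.

data Mark : Set where
  vtx edg : Mark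

Pos : Set
Pos = List ℕ × Mark

PosSet : Set
PosSet = Pos → Bool

_∈ₚ_ : Pos → PosSet → Set
q ∈ₚ S = S q ≡ true

FiniteUpTo : {A : Set} → Rel A 0ℓ → Set
FiniteUpTo {A} _≈_ = Σ (List A) λ xs → ∀ x → Any (λ y → x ≈ y) xs

record OrderIso {A B : Set} (_≈A_ _≤A_ : Rel A 0ℓ) (_≈B_ _≤B_ : Rel B 0ℓ) : Set where
  field
    to        : A → B
    from      : B → A
    to-cong   : ∀ {x y} → x ≈A y → to x ≈B to y
    from-cong : ∀ {x y} → x ≈B y → from x ≈A from y
    from∘to   : ∀ x → from (to x) ≈A x
    to∘from   : ∀ y → to (from y) ≈B y
    order     : ∀ x y → (x ≤A y) ⇔ (to x ≤B to y)

lookupℕ : {A : Set} {n : ℕ} → Vec A n → ℕ → A → A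
lookupℕ []       k       d = d
lookupℕ (x ∷ xs) zero    d = x
lookupℕ (x ∷ xs) (suc k) d = lookupℕ xs k d

-- Everything below is relative to a signature: symbols F with arities ar.
-- First-order variable x_{k+1} is represented as index k.

module _ {F : Set} (ar : F → ℕ) where

  data Term : Set where
    var : ℕ → Term
    fun : (f : F) → Vec Term (ar f) → Term

  -- Tree interpretation with variables interpreted as ∅.
  -- Child i (as Fin) gets the positive number suc (toℕ i).
  data TreePos : Term → Pos → Set where
    rootV : ∀ {f ts} → TreePos (fun f ts) ([] , vtx)
    rootE : ∀ {f ts} → TreePos (fun f ts) ([] , edg)
    child : ∀ {f ts p m} (i : Fin (ar f)) →
            TreePos (lookup ts i) (p , m) →
            TreePos (fun f ts) (suc (toℕ i) ∷ p , m)

  Internal : Term → Pos → Set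
  Internal t q = TreePos t q × q ≢ ([] , edg)

  record GeomCluster (t : Term) (S : PosSet) : Set where
    field
      internal : ∀ q → q ∈ₚ S → Internal t q
      closed   : ∀ p i → (p ++ [ i ] , edg) ∈ₚ S →
                 ((p , vtx) ∈ₚ S) × ((p ++ [ i ] , vtx) ∈ₚ S)

  GC : Term → Set
  GC t = Σ PosSet (GeomCluster t)

  _⊆G_ : {t : Term} → Rel (GC t) 0ℓ
  (S , _) ⊆G (S' , _) = ∀ q → q ∈ₚ S → q ∈ₚ S'

  _≈G_ : {t : Term} → Rel (GC t) 0ℓ
  A ≈G B = (A ⊆G B) × (B ⊆G A)

  -- A gap variable: (name , arity).
  GapVar : Set
  GapVar = ℕ × ℕ

  data Skel : Set where
    svar : ℕ → Skel
    sfun : (f : F) → Vec Skel (ar f) → Skel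
    sgap : (Z : GapVar) → Vec Skel (proj₂ Z) → Skel

  mutual
    ⌜_⌝ : Term → Skel
    ⌜ var k ⌝    = svar k
    ⌜ fun f ts ⌝ = sfun f (⌜_⌝s ts)

    ⌜_⌝s : ∀ {n} → Vec Term n → Vec Skel n
    ⌜ [] ⌝s     = []
    ⌜ t ∷ ts ⌝s = ⌜ t ⌝ ∷ ⌜ ts ⌝s

  mutual
    varsOf : Skel → List ℕ
    varsOf (svar k)    = k ∷ []
    varsOf (sfun f ss) = varsOfs ss
    varsOf (sgap Z ss) = varsOfs ss

    varsOfs : ∀ {n} → Vec Skel n → List ℕ
    varsOfs []       = []
    varsOfs (s ∷ ss) = varsOf s ++ varsOfs ss

  mutual
    gapsOf : Skel → List GapVar
    gapsOf (svar k)    = []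
    gapsOf (sfun f ss) = gapsOfs ss
    gapsOf (sgap Z ss) = Z ∷ gapsOfs ss

    gapsOfs : ∀ {n} → Vec Skel n → List GapVar
    gapsOfs []       = []
    gapsOfs (s ∷ ss) = gapsOf s ++ gapsOfs ss

  IsVar : Skel → Set
  IsVar (svar _)    = ⊤
  IsVar (sfun _ _)  = ⊥
  IsVar (sgap _ _)  = ⊥

  -- pattern-skeleton of arity n: not a variable, and standard
  -- (variables read left to right are exactly x_1, ..., x_n)
  PatternSkel : ℕ → Skel → Set
  PatternSkel n s = ¬ IsVar s × varsOf s ≡ upTo n

  Pattern : ℕ → Term → Set
  Pattern n ℓ = PatternSkel n ⌜ ℓ ⌝

  mutual
    instT : ∀ {n} → Term → Vec Term n → Term
    instT (var k)    σ = lookupℕ σ k (var k)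
    instT (fun f ts) σ = fun f (instTs ts σ)

    instTs : ∀ {n m} → Vec Term m → Vec Term n → Vec Term m
    instTs []       σ = []
    instTs (t ∷ ts) σ = instT t σ ∷ instTs ts σ

  mutual
    instS : ∀ {n} → Skel → Vec Skel n → Skel
    instS (svar k)    σ = lookupℕ σ k (svar k)
    instS (sfun f ss) σ = sfun f (instSs ss σ)
    instS (sgap Z ss) σ = sgap Z (instSs ss σ)

    instSs : ∀ {n m} → Vec Skel m → Vec Skel n → Vec Skel m
    instSs []       σ = []
    instSs (s ∷ ss) σ = instS s σ ∷ instSs ss σ

  mutual
    soT : (GapVar → Term) → Skel → Term
    soT α (svar k)    = var k
    soT α (sfun f ss) = fun f (soTs α ss)
    soT α (sgap Z ss) = instT (α Z) (soTs α ss)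

    soTs : ∀ {m} → (GapVar → Term) → Vec Skel m → Vec Term m
    soTs α []       = []
    soTs α (s ∷ ss) = soT α s ∷ soTs α ss

  mutual
    soS : (GapVar → Skel) → Skel → Skel
    soS γ (svar k)    = svar k
    soS γ (sfun f ss) = sfun f (soSs γ ss)
    soS γ (sgap Z ss) = instS (γ Z) (soSs γ ss)

    soSs : ∀ {m} → (GapVar → Skel) → Vec Skel m → Vec Skel m
    soSs γ []       = []
    soSs γ (s ∷ ss) = soS γ s ∷ soSs γ ss

  -- A candidate pair (M , [Z := α Z]); only the values of α on the
  -- gaps of M are meaningful.
  Pair : Set
  Pair = Skel × (GapVar → Term)

  record IsIndCluster (P : Pair) : Set where
    field
      linear   : Unique (gapsOf (proj₁ P))
      patterns : ∀ Z → Z ∈ gapsOf (proj₁ P) → Pattern (proj₂ Z) (proj₂ P Z)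

  IsIndClusterFor : Term → Pair → Set
  IsIndClusterFor t P = IsIndCluster P × soT (proj₂ P) (proj₁ P) ≡ t

  IC : Term → Set
  IC t = Σ Pair (IsIndClusterFor t)

  _⊒_ : Pair → Pair → Set
  (N , β) ⊒ (M , α) = Σ (GapVar → Skel) λ γ →
      (∀ Z → Z ∈ gapsOf N → PatternSkel (proj₂ Z) (γ Z))
    × soS γ N ≡ M
    × (∀ Z → Z ∈ gapsOf N → β Z ≡ soT α (γ Z))

  _⊑_ : Pair → Pair → Set
  P ⊑ Q = Q ⊒ P

  _⊑I_ : {t : Term} → Rel (IC t) 0ℓ
  A ⊑I B = proj₁ A ⊑ proj₁ B

  renG : (ℕ → ℕ → ℕ) → GapVar → GapVar
  renG ρ Z = ρ (proj₁ Z) (proj₂ Z) , proj₂ Z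

  mutual
    renS : (ℕ → ℕ → ℕ) → Skel → Skel
    renS ρ (svar k)    = svar k
    renS ρ (sfun f ss) = sfun f (renSs ρ ss)
    renS ρ (sgap Z ss) = sgap (renG ρ Z) (renSs ρ ss)

    renSs : ∀ {m} → (ℕ → ℕ → ℕ) → Vec Skel m → Vec Skel m
    renSs ρ []       = []
    renSs ρ (s ∷ ss) = renS ρ s ∷ renSs ρ ss

  _≈R_ : Pair → Pair → Set
  (M , α) ≈R (N , β) = Σ (ℕ → ℕ → ℕ) λ ρ →
      (∀ Z Z' → Z ∈ gapsOf M → Z' ∈ gapsOf M → renG ρ Z ≡ renG ρ Z' → Z ≡ Z')
    × renS ρ M ≡ N
    × (∀ Z → Z ∈ gapsOf M → β (renG ρ Z) ≡ α Z)

  _≈I_ : {t : Term} → Rel (IC t) 0ℓ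
  A ≈I B = proj₁ A ≈R proj₁ B

-- Both posets are identified with the closed decorations of t: markings of the vertices
-- and edges of the term tree of t in which every marked edge has both endpoints marked.
-- A geometric cluster is such a marking. An inductive cluster (M , α) marks the inside
-- of its patterns α Z, and coarsening enlarges the patterns, so the marking grows.
-- Conversely every closed marking is carved into a canonical inductive cluster whose gaps
-- are its maximal connected marked regions; and if the marking of (M , α) is contained in
-- that of (N , β), cutting M along the patterns of N exhibits (N , β) as a coarsening of
-- (M , α), which is a mere renaming of gaps when the markings coincide. Geometric clusters
-- are closed under union and intersection, hence form a finite distributive lattice, and
-- the isomorphism transports this structure to the inductive side.

module Submission where

open import Defs
open import Data.Nat using (ℕ)
open import Data.Product using (Σ; _×_; _,_)
open import Relation.Binary.Lattice.Structures using (IsDistributiveLattice)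
open import Relation.Binary.PropositionalEquality using (_≡_; refl; sym; trans; cong; subst)

module Prelude where

  open import Data.Bool using (Bool; true; false; _∨_; _∧_)
  open import Data.Bool.Properties using (∨-zeroʳ)
  open import Data.Empty using (⊥-elim)
  open import Data.Nat using (ℕ; zero; suc; _+_; _<_; _≤_; s≤s; z≤n)
  open import Data.Nat.Properties
    using (+-assoc; +-suc; +-identityʳ; m≤m+n; <-≤-trans; +-monoʳ-<; ≤-refl; <⇒≤; <-irrefl)
  open import Data.List using (List; []; _∷_; _++_; length; map; applyUpTo; upTo)
  open import Data.List.Properties using (length-++)
  open import Data.List.Membership.Propositional using (_∈_; _∉_)
  open import Data.List.Membership.Propositional.Properties using (∈-++⁺ʳ; ∈-map⁺)
  open import Data.List.Relation.Unary.Any using (here; there)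
  open import Data.List.Relation.Unary.All as All using (All; []; _∷_)
  open import Data.List.Relation.Unary.All.Properties using (++⁻ˡ)
  open import Data.List.Relation.Unary.Unique.Propositional using (Unique)
  open import Data.List.Relation.Unary.AllPairs using ([]; _∷_)
  open import Data.Vec using (Vec; []; _∷_; fromList)
  open import Data.Unit using (⊤; tt)
  open import Data.Product using (_×_; _,_)
  open import Data.Sum using (_⊎_; inj₁; inj₂)
  open import Relation.Binary.PropositionalEquality using (_≡_; refl; sym; trans; cong; cong₂; subst; subst₂)
  open import Defs using (lookupℕ)

  ∨-true-split : ∀ a b → a ∨ b ≡ true → a ≡ true ⊎ b ≡ true
  ∨-true-split true  b _ = inj₁ refl
  ∨-true-split false b h = inj₂ h

  ∨-introˡ : ∀ {a} b → a ≡ true → a ∨ b ≡ true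
  ∨-introˡ b refl = refl

  ∨-introʳ : ∀ a {b} → b ≡ true → a ∨ b ≡ true
  ∨-introʳ a refl = ∨-zeroʳ a

  ∧-true-intro : ∀ {a b} → a ≡ true → b ≡ true → a ∧ b ≡ true
  ∧-true-intro refl refl = refl

  lookupListℕ : {A : Set} → List A → ℕ → A → A
  lookupListℕ []       j       d = d
  lookupListℕ (x ∷ xs) zero    d = x
  lookupListℕ (x ∷ xs) (suc j) d = lookupListℕ xs j d

  lookupℕ-fromList : {A : Set} (xs : List A) (k : ℕ) (d : A) → lookupℕ (fromList xs) k d ≡ lookupListℕ xs k d
  lookupℕ-fromList []       k       d = refl
  lookupℕ-fromList (x ∷ xs) zero    d = refl
  lookupℕ-fromList (x ∷ xs) (suc k) d = lookupℕ-fromList xs k d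

  lookupListℕ-++ˡ : {A : Set} (xs ys : List A) (j : ℕ) (d : A) → j < length xs →
                    lookupListℕ (xs ++ ys) j d ≡ lookupListℕ xs j d
  lookupListℕ-++ˡ (x ∷ xs) ys zero    d _         = refl
  lookupListℕ-++ˡ (x ∷ xs) ys (suc j) d (s≤s j<) = lookupListℕ-++ˡ xs ys j d j<

  lookupListℕ-++ʳ : {A : Set} (xs ys : List A) (j : ℕ) (d : A) →
                    lookupListℕ (xs ++ ys) (length xs + j) d ≡ lookupListℕ ys j d
  lookupListℕ-++ʳ []       ys j d = refl
  lookupListℕ-++ʳ (x ∷ xs) ys j d = lookupListℕ-++ʳ xs ys j d

  lookupListℕ-default : {A : Set} (xs : List A) (j : ℕ) (d d' : A) → j < length xs →
                        lookupListℕ xs j d ≡ lookupListℕ xs j d'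
  lookupListℕ-default (x ∷ xs) zero    d d' _         = refl
  lookupListℕ-default (x ∷ xs) (suc j) d d' (s≤s j<) = lookupListℕ-default xs j d d' j<

  AllFrom : {A : Set} → (ℕ → A → Set) → ℕ → List A → A → Set
  AllFrom P k xs d = ∀ j → j < length xs → P (k + j) (lookupListℕ xs j d)

  module _ {A : Set} {P : ℕ → A → Set} {k : ℕ} {d : A} where

    allFrom-++ˡ : (xs ys : List A) → AllFrom P k (xs ++ ys) d → AllFrom P k xs d
    allFrom-++ˡ xs ys h j j< = subst (P (k + j)) (lookupListℕ-++ˡ xs ys j d j<)
      (h j (subst (j <_) (sym (length-++ xs)) (<-≤-trans j< (m≤m+n _ (length ys)))))

    allFrom-++ʳ : (xs ys : List A) → AllFrom P k (xs ++ ys) d → AllFrom P (k + length xs) ys d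
    allFrom-++ʳ xs ys h j j< = subst₂ P (sym (+-assoc k (length xs) j)) (lookupListℕ-++ʳ xs ys j d)
      (h (length xs + j) (subst (length xs + j <_) (sym (length-++ xs)) (+-monoʳ-< (length xs) j<)))

    allFrom-∷ : (x : A) (xs : List A) → AllFrom P k (x ∷ xs) d → P k x × AllFrom P (suc k) xs d
    allFrom-∷ x xs h = subst (λ i → P i x) (+-identityʳ k) (h zero (s≤s z≤n)) ,
      λ j j< → subst (λ i → P i (lookupListℕ xs j d)) (+-suc k j) (h (suc j) (s≤s j<))

  interval : ℕ → ℕ → List ℕ
  interval k zero    = []
  interval k (suc n) = k ∷ interval (suc k) n

  interval-++ : ∀ k m n → interval k (m + n) ≡ interval k m ++ interval (k + m) n
  interval-++ k zero    n = cong (λ i → interval i n) (sym (+-identityʳ k))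
  interval-++ k (suc m) n = cong (k ∷_) (trans (interval-++ (suc k) m n)
                                               (cong (λ i → interval (suc k) m ++ interval i n) (sym (+-suc k m))))

  applyUpTo-interval : ∀ (f : ℕ → ℕ) k n → (∀ i → f i ≡ k + i) → applyUpTo f n ≡ interval k n
  applyUpTo-interval f k zero    f≗k+ = refl
  applyUpTo-interval f k (suc n) f≗k+ = cong₂ _∷_ (trans (f≗k+ 0) (+-identityʳ k))
    (applyUpTo-interval (λ i → f (suc i)) (suc k) n (λ i → trans (f≗k+ (suc i)) (+-suc k i)))

  upTo-interval : ∀ n → upTo n ≡ interval 0 n
  upTo-interval n = applyUpTo-interval (λ i → i) 0 n (λ i → refl)

  interval-length : ∀ k n → length (interval k n) ≡ n
  interval-length k zero    = refl
  interval-length k (suc n) = cong suc (interval-length (suc k) n)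

  interval-≥ : ∀ {j k n} → j ∈ interval k n → k ≤ j
  interval-≥ {n = suc n} (here refl) = ≤-refl
  interval-≥ {n = suc n} (there j∈) = <⇒≤ (interval-≥ j∈)

  ∈interval⇒< : ∀ {j k n} → j ∈ interval k n → j < k + n
  ∈interval⇒< {k = k} {suc n} (here refl) = subst (k <_) (sym (+-suc k n)) (s≤s (m≤m+n k n))
  ∈interval⇒< {j} {k} {suc n} (there j∈) = subst (j <_) (sym (+-suc k n)) (∈interval⇒< j∈)

  <⇒∈interval : ∀ {j n} → j < n → j ∈ interval 0 n
  <⇒∈interval = go 0
    where
      go : ∀ k {j n} → j < n → k + j ∈ interval k n
      go k {zero}  {suc n} _         = here (+-identityʳ k)
      go k {suc j} {suc n} (s≤s j<n) = there (subst (_∈ interval (suc k) n) (sym (+-suc k j)) (go (suc k) j<n))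

  interval-unique : ∀ k n → Unique (interval k n)
  interval-unique k zero    = []
  interval-unique k (suc n) =
    All.tabulate (λ j∈ k≡j → <-irrefl k≡j (interval-≥ j∈)) ∷ interval-unique (suc k) n

  unique-++ˡ : ∀ {A : Set} (xs ys : List A) → Unique (xs ++ ys) → Unique xs
  unique-++ˡ []       ys u         = []
  unique-++ˡ (x ∷ xs) ys (x∉ ∷ u) = ++⁻ˡ xs x∉ ∷ unique-++ˡ xs ys u

  unique-++ʳ : ∀ {A : Set} (xs ys : List A) → Unique (xs ++ ys) → Unique ys
  unique-++ʳ []       ys u        = u
  unique-++ʳ (x ∷ xs) ys (_ ∷ u) = unique-++ʳ xs ys u

  unique-++-disjoint : ∀ {A : Set} (xs : List A) {ys i} → Unique (xs ++ ys) → i ∈ ys → i ∉ xs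
  unique-++-disjoint (x ∷ xs) (x∉ ∷ u) i∈ys (here refl) = All.lookup x∉ (∈-++⁺ʳ xs i∈ys) refl
  unique-++-disjoint (x ∷ xs) (_  ∷ u) i∈ys (there i∈xs) = unique-++-disjoint xs u i∈ys i∈xs

  unique-map-injective : ∀ {A B : Set} (f : A → B) {xs} → Unique (map f xs) →
                         ∀ {x y} → x ∈ xs → y ∈ xs → f x ≡ f y → x ≡ y
  unique-map-injective f (_  ∷ u) (here refl) (here refl) _   = refl
  unique-map-injective f (fx∉ ∷ u) (here refl) (there y∈) fx≡fy = ⊥-elim (All.lookup fx∉ (∈-map⁺ f y∈) fx≡fy)
  unique-map-injective f (fy∉ ∷ u) (there x∈) (here refl) fx≡fy = ⊥-elim (All.lookup fy∉ (∈-map⁺ f x∈) (sym fx≡fy))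
  unique-map-injective f (_  ∷ u) (there x∈) (there y∈) fx≡fy = unique-map-injective f u x∈ y∈ fx≡fy

  lookupℕ-default : ∀ {A : Set} {n} (ys : Vec A n) j (d d' : A) → j < n → lookupℕ ys j d ≡ lookupℕ ys j d'
  lookupℕ-default (y ∷ ys) zero    d d' _         = refl
  lookupℕ-default (y ∷ ys) (suc j) d d' (s≤s j<) = lookupℕ-default ys j d d' j<

  AllAt : ∀ {A : Set} → (ℕ → A → Set) → ∀ {n} → Vec A n → ℕ → Set
  AllAt P []       j0 = ⊤
  AllAt P (y ∷ ys) j0 = P j0 y × AllAt P ys (suc j0)

  allAt : ∀ {A : Set} (P : ℕ → A → Set) {n} (ys : Vec A n) j0 d →
          (∀ j → j < n → P (j0 + j) (lookupℕ ys j d)) → AllAt P ys j0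
  allAt P []       j0 d h = tt
  allAt P (y ∷ ys) j0 d h = subst (λ i → P i y) (+-identityʳ j0) (h zero (s≤s z≤n)) ,
    allAt P ys (suc j0) d (λ j j< → subst (λ i → P i (lookupℕ ys j d)) (+-suc j0 j) (h (suc j) (s≤s j<)))

  allAt-lookup : ∀ {A : Set} {P : ℕ → A → Set} {n} (ys : Vec A n) j0 → AllAt P ys j0 →
                 ∀ j d → j < n → P (j0 + j) (lookupℕ ys j d)
  allAt-lookup {P = P} (y ∷ ys) j0 (p , ps) zero    d _         = subst (λ i → P i y) (sym (+-identityʳ j0)) p
  allAt-lookup {P = P} (y ∷ ys) j0 (p , ps) (suc j) d (s≤s j<) =
    subst (λ i → P i (lookupℕ ys j d)) (sym (+-suc j0 j)) (allAt-lookup ys (suc j0) ps j d j<)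

module Order where

  open import Level using (0ℓ)
  open import Data.Bool using (Bool; true; _∨_; _∧_)
  open import Data.List using (map)
  open import Data.List.Relation.Unary.Any as Any using ()
  open import Data.List.Relation.Unary.Any.Properties using (map⁺)
  open import Data.Product using (Σ; _×_; _,_; proj₁)
  open import Data.Sum using ([_,_]′)
  open import Function.Bundles using (mk⇔)
  open import Relation.Binary.Core using (Rel)
  open import Relation.Binary.Structures using (IsPartialOrder)
  open import Relation.Binary.Lattice.Structures using (IsDistributiveLattice)
  open import Relation.Binary.Lattice.Bundles using (Lattice)
  import Relation.Binary.Lattice.Properties.JoinSemilattice as JoinProperties
  import Relation.Binary.Lattice.Properties.MeetSemilattice as MeetProperties
  import Relation.Binary.Reasoning.Setoid as SetoidReasoning
  open import Relation.Binary.PropositionalEquality using (_≡_; refl; sym; trans)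
  open import Defs using (FiniteUpTo; OrderIso)
  open Prelude using (∨-true-split; ∨-introˡ; ∨-introʳ; ∧-true-intro)

  module OrderEmbedding
    {A B : Set} {_≈A_ _≤A_ : Rel A 0ℓ} (isPartialOrder : IsPartialOrder _≈A_ _≤A_)
    (_≈B_ _≤B_ : Rel B 0ℓ) (emb : B → A) (sec : A → B)
    (≈-preserve : ∀ {y y'} → y ≈B y' → emb y ≈A emb y')
    (≈-reflect  : ∀ {y y'} → emb y ≈A emb y' → y ≈B y')
    (≤-preserve : ∀ {y y'} → y ≤B y' → emb y ≤A emb y')
    (≤-reflect  : ∀ {y y'} → emb y ≤A emb y' → y ≤B y')
    (emb∘sec    : ∀ x → emb (sec x) ≈A x)
    where

    open IsPartialOrder isPartialOrder
      using (module Eq; reflexive; antisym; ≤-respˡ-≈; ≤-respʳ-≈)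
      renaming (trans to ≤-trans)

    orderIso : OrderIso _≈A_ _≤A_ _≈B_ _≤B_
    orderIso = record
      { to        = sec
      ; from      = emb
      ; to-cong   = λ {x} {y} x≈y →
          ≈-reflect (Eq.trans (emb∘sec x) (Eq.trans x≈y (Eq.sym (emb∘sec y))))
      ; from-cong = ≈-preserve
      ; from∘to   = emb∘sec
      ; to∘from   = λ y → ≈-reflect (emb∘sec (emb y))
      ; order     = λ x y → mk⇔
          (λ x≤y → ≤-reflect (≤-respˡ-≈ (Eq.sym (emb∘sec x)) (≤-respʳ-≈ (Eq.sym (emb∘sec y)) x≤y)))
          (λ sx≤sy → ≤-respˡ-≈ (emb∘sec x) (≤-respʳ-≈ (emb∘sec y) (≤-preserve sx≤sy)))
      }

    finite : FiniteUpTo _≈A_ → FiniteUpTo _≈B_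
    finite (xs , covers) = map sec xs , λ y →
      map⁺ (Any.map (λ {x} y≈x → ≈-reflect (Eq.trans y≈x (Eq.sym (emb∘sec x)))) (covers (emb y)))

    module _ {_∨_ _∧_ : A → A → A}
             (isDistributiveLattice : IsDistributiveLattice _≈A_ _≤A_ _∨_ _∧_) where

      open IsDistributiveLattice isDistributiveLattice using (isLattice; supremum; infimum; ∧-distribˡ-∨)

      private
        lattice : Lattice 0ℓ 0ℓ 0ℓ
        lattice = record { isLattice = isLattice }

      open JoinProperties (Lattice.joinSemilattice lattice) using (∨-cong)
      open MeetProperties (Lattice.meetSemilattice lattice) using (∧-cong)

      _∨B_ _∧B_ : B → B → B
      x ∨B y = sec (emb x ∨ emb y)
      x ∧B y = sec (emb x ∧ emb y)

      private
        ≤-sec : ∀ {x y} → x ≤A y → x ≤A emb (sec y)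
        ≤-sec = ≤-respʳ-≈ (Eq.sym (emb∘sec _))

        sec-≤ : ∀ {x y} → x ≤A y → emb (sec x) ≤A y
        sec-≤ = ≤-respˡ-≈ (Eq.sym (emb∘sec _))

        distrib : ∀ x y z → emb (x ∧B (y ∨B z)) ≈A emb ((x ∧B y) ∨B (x ∧B z))
        distrib x y z = begin
          emb (sec (emb x ∧ emb (sec (emb y ∨ emb z))))  ≈⟨ emb∘sec _ ⟩
          emb x ∧ emb (sec (emb y ∨ emb z))              ≈⟨ ∧-cong Eq.refl (emb∘sec _) ⟩
          emb x ∧ (emb y ∨ emb z)                        ≈⟨ ∧-distribˡ-∨ (emb x) (emb y) (emb z) ⟩
          (emb x ∧ emb y) ∨ (emb x ∧ emb z)              ≈⟨ ∨-cong (Eq.sym (emb∘sec _)) (Eq.sym (emb∘sec _)) ⟩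
          emb (x ∧B y) ∨ emb (x ∧B z)                    ≈⟨ Eq.sym (emb∘sec _) ⟩
          emb ((x ∧B y) ∨B (x ∧B z))                     ∎
          where open SetoidReasoning (Lattice.setoid lattice)

      transportedIsDistributiveLattice : IsDistributiveLattice _≈B_ _≤B_ _∨B_ _∧B_
      transportedIsDistributiveLattice = record
        { isLattice = record
          { isPartialOrder = record
            { isPreorder = record
              { isEquivalence = record
                { refl  = ≈-reflect Eq.refl
                ; sym   = λ x≈y → ≈-reflect (Eq.sym (≈-preserve x≈y))
                ; trans = λ x≈y y≈z → ≈-reflect (Eq.trans (≈-preserve x≈y) (≈-preserve y≈z))
                }
              ; reflexive = λ x≈y → ≤-reflect (reflexive (≈-preserve x≈y))
              ; trans     = λ x≤y y≤z → ≤-reflect (≤-trans (≤-preserve x≤y) (≤-preserve y≤z))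
              }
            ; antisym = λ x≤y y≤x → ≈-reflect (antisym (≤-preserve x≤y) (≤-preserve y≤x))
            }
          ; supremum = λ x y → let (x≤x∨y , y≤x∨y , least) = supremum (emb x) (emb y) in
              ≤-reflect (≤-sec x≤x∨y) , ≤-reflect (≤-sec y≤x∨y) ,
              λ z x≤z y≤z → ≤-reflect (sec-≤ (least (emb z) (≤-preserve x≤z) (≤-preserve y≤z)))
          ; infimum = λ x y → let (x∧y≤x , x∧y≤y , greatest) = infimum (emb x) (emb y) in
              ≤-reflect (sec-≤ x∧y≤x) , ≤-reflect (sec-≤ x∧y≤y) ,
              λ z z≤x z≤y → ≤-reflect (≤-sec (greatest (emb z) (≤-preserve z≤x) (≤-preserve z≤y)))
          }
        ; ∧-distribˡ-∨ = λ x y z → ≈-reflect (distrib x y z)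
        }

  module SubsetLattice {X : Set} (Admissible : (X → Bool) → Set)
    (∪-closed : ∀ {S S'} → Admissible S → Admissible S' → Admissible (λ x → S x ∨ S' x))
    (∩-closed : ∀ {S S'} → Admissible S → Admissible S' → Admissible (λ x → S x ∧ S' x))
    where

    open import Data.Bool.Properties using (∧-conicalˡ; ∧-conicalʳ; ∧-distribˡ-∨)

    Subset : Set
    Subset = Σ (X → Bool) Admissible

    _⊆_ _≈_ : Rel Subset 0ℓ
    A ⊆ B = ∀ x → proj₁ A x ≡ true → proj₁ B x ≡ true
    A ≈ B = A ⊆ B × B ⊆ A

    _∪_ _∩_ : Subset → Subset → Subset
    (S , cS) ∪ (S' , cS') = (λ x → S x ∨ S' x) , ∪-closed cS cS'
    (S , cS) ∩ (S' , cS') = (λ x → S x ∧ S' x) , ∩-closed cS cS'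

    isPartialOrder : IsPartialOrder _≈_ _⊆_
    isPartialOrder = record
      { isPreorder = record
        { isEquivalence = record
          { refl  = (λ _ h → h) , (λ _ h → h)
          ; sym   = λ (A⊆B , B⊆A) → B⊆A , A⊆B
          ; trans = λ (A⊆B , B⊆A) (B⊆C , C⊆B) → (λ x h → B⊆C x (A⊆B x h)) , (λ x h → B⊆A x (C⊆B x h))
          }
        ; reflexive = proj₁
        ; trans     = λ A⊆B B⊆C x h → B⊆C x (A⊆B x h)
        }
      ; antisym = _,_
      }

    isDistributiveLattice : IsDistributiveLattice _≈_ _⊆_ _∪_ _∩_
    isDistributiveLattice = record
      { isLattice = record
        { isPartialOrder = isPartialOrder
        ; supremum = λ A B →
            (λ x → ∨-introˡ (proj₁ B x)) , (λ x → ∨-introʳ (proj₁ A x)) ,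
            λ C A⊆C B⊆C x h → [ A⊆C x , B⊆C x ]′ (∨-true-split (proj₁ A x) (proj₁ B x) h)
        ; infimum = λ A B →
            (λ x → ∧-conicalˡ _ _) , (λ x → ∧-conicalʳ _ _) ,
            λ C C⊆A C⊆B x h → ∧-true-intro (C⊆A x h) (C⊆B x h)
        }
      ; ∧-distribˡ-∨ = λ A B C →
          let eq x = ∧-distribˡ-∨ (proj₁ A x) (proj₁ B x) (proj₁ C x) in
          (λ x h → trans (sym (eq x)) h) , (λ x h → trans (eq x) h)
      }

module Decorations where

  open import Defs
  open import Data.Nat using (ℕ; zero; suc)
  open import Data.Bool using (Bool; true; false; _≤_; f≤t; b≤b)
  open import Data.Bool.Properties using (≤-minimum)
  open import Data.List using (List; []; _∷_; _++_; [_])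
  open import Data.Product using (_×_; _,_; proj₁; proj₂)
  open import Data.Unit using (⊤; tt)
  open import Data.Empty using (⊥-elim)
  open import Relation.Binary.PropositionalEquality using (_≡_; refl; sym; trans; _≢_)

  -- A decoration marks internal positions of a term: `hole` stands for a variable
  -- (which has no internal positions), `node b es` for a function-symbol vertex,
  -- marked iff b, with one pair (edge mark, decoration) per argument.
  data Deco : Set where
    hole : Deco
    node : Bool → List (Bool × Deco) → Deco

  nthDeco : List Deco → ℕ → Deco
  nthDeco [] k = hole
  nthDeco (d ∷ ds) zero = d
  nthDeco (d ∷ ds) (suc k) = nthDeco ds k

  root : Deco → Bool
  root hole = false
  root (node b _) = b

  mutual
    data _≼_ : Deco → Deco → Set where
      hole≼ : ∀ {d} → hole ≼ d
      node≼ : ∀ {b b' cs cs'} → b ≤ b' → cs ≼* cs' → node b cs ≼ node b' cs'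
    data _≼*_ : List (Bool × Deco) → List (Bool × Deco) → Set where
      []≼ : [] ≼* []
      ∷≼ : ∀ {e e' d d' cs cs'} → e ≤ e' → d ≼ d' → cs ≼* cs' →
           ((e , d) ∷ cs) ≼* ((e' , d') ∷ cs')

  mutual
    Closed : Deco → Set
    Closed hole = ⊤
    Closed (node b cs) = ClosedBelow b cs
    ClosedBelow : Bool → List (Bool × Deco) → Set
    ClosedBelow b [] = ⊤
    ClosedBelow b ((e , d) ∷ cs) = (e ≡ true → b ≡ true × root d ≡ true) × Closed d × ClosedBelow b cs

  mutual
    posOf : Deco → PosSet
    posOf hole q = false
    posOf (node b cs) ([] , vtx) = b
    posOf (node b cs) ([] , edg) = false
    posOf (node b cs) (zero ∷ p , m) = false
    posOf (node b cs) (suc i ∷ p , m) = posOfArgs cs i (p , m)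
    posOfArgs : List (Bool × Deco) → ℕ → PosSet
    posOfArgs [] i q = false
    posOfArgs ((e , d) ∷ cs) zero q = posOfEdge e d q
    posOfArgs (c ∷ cs) (suc i) q = posOfArgs cs i q
    posOfEdge : Bool → Deco → PosSet
    posOfEdge e d ([] , edg) = e
    posOfEdge e d ([] , vtx) = posOf d ([] , vtx)
    posOfEdge e d (x ∷ p , m) = posOf d (x ∷ p , m)

  posOf-rootVertex : ∀ d → posOf d ([] , vtx) ≡ root d
  posOf-rootVertex hole = refl
  posOf-rootVertex (node b cs) = refl

  posOf-rootEdge : ∀ d → posOf d ([] , edg) ≡ false
  posOf-rootEdge hole = refl
  posOf-rootEdge (node b cs) = refl

  posOfEdge-vertex : ∀ e d p → posOfEdge e d (p , vtx) ≡ posOf d (p , vtx)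
  posOfEdge-vertex e d [] = refl
  posOfEdge-vertex e d (x ∷ p) = refl

  posOfEdge-snoc : ∀ e d p i m → posOfEdge e d (p ++ [ i ] , m) ≡ posOf d (p ++ [ i ] , m)
  posOfEdge-snoc e d [] i m = refl
  posOfEdge-snoc e d (x ∷ p) i m = refl

  posOfEdge-notRootEdge : ∀ e d q → q ≢ ([] , edg) → posOfEdge e d q ≡ posOf d q
  posOfEdge-notRootEdge e d ([] , vtx) ne = refl
  posOfEdge-notRootEdge e d ([] , edg) ne = ⊥-elim (ne refl)
  posOfEdge-notRootEdge e d (x ∷ p , m) ne = refl

  mutual
    posOf-mono : ∀ {d d'} → d ≼ d' → ∀ q → posOf d q ≡ true → posOf d' q ≡ true
    posOf-mono hole≼ q ()
    posOf-mono (node≼ f≤t c) ([] , vtx) h = refl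
    posOf-mono (node≼ b≤b c) ([] , vtx) h = h
    posOf-mono (node≼ x c) ([] , edg) ()
    posOf-mono (node≼ x c) (zero ∷ p , m) ()
    posOf-mono (node≼ x c) (suc i ∷ p , m) h = posOfArgs-mono c i (p , m) h
    posOfArgs-mono : ∀ {cs cs'} → cs ≼* cs' → ∀ i q → posOfArgs cs i q ≡ true → posOfArgs cs' i q ≡ true
    posOfArgs-mono []≼ i q ()
    posOfArgs-mono (∷≼ le dle c) zero ([] , edg) h with le
    ... | f≤t = refl
    ... | b≤b = h
    posOfArgs-mono (∷≼ le dle c) zero ([] , vtx) h = posOf-mono dle ([] , vtx) h
    posOfArgs-mono (∷≼ le dle c) zero (x ∷ p , m) h = posOf-mono dle (x ∷ p , m) h
    posOfArgs-mono (∷≼ le dle c) (suc i) q h = posOfArgs-mono c i q h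

  EdgeClosed : PosSet → Set
  EdgeClosed S = ∀ p i → S (p ++ [ i ] , edg) ≡ true → (S (p , vtx) ≡ true) × (S (p ++ [ i ] , vtx) ≡ true)

  mutual
    posOf-edgeClosed : ∀ d → Closed d → EdgeClosed (posOf d)
    posOf-edgeClosed hole v p i ()
    posOf-edgeClosed (node b cs) v [] zero ()
    posOf-edgeClosed (node b cs) v [] (suc i) h = posOfArgs-edgeClosed-root b cs v i h
    posOf-edgeClosed (node b cs) v (zero ∷ p) i ()
    posOf-edgeClosed (node b cs) v (suc x ∷ p) i h = posOfArgs-edgeClosed b cs v x p i h

    posOfArgs-edgeClosed-root : ∀ b cs → ClosedBelow b cs → ∀ i → posOfArgs cs i ([] , edg) ≡ true →
                (b ≡ true) × (posOfArgs cs i ([] , vtx) ≡ true)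
    posOfArgs-edgeClosed-root b [] v i ()
    posOfArgs-edgeClosed-root b ((e , d) ∷ cs) (ve , vd , vc) zero h =
      proj₁ (ve h) , trans (posOf-rootVertex d) (proj₂ (ve h))
    posOfArgs-edgeClosed-root b ((e , d) ∷ cs) (ve , vd , vc) (suc i) h = posOfArgs-edgeClosed-root b cs vc i h

    posOfArgs-edgeClosed : ∀ b cs → ClosedBelow b cs → ∀ x p i → posOfArgs cs x (p ++ [ i ] , edg) ≡ true →
               (posOfArgs cs x (p , vtx) ≡ true) × (posOfArgs cs x (p ++ [ i ] , vtx) ≡ true)
    posOfArgs-edgeClosed b [] v x p i ()
    posOfArgs-edgeClosed b ((e , d) ∷ cs) (ve , vd , vc) zero p i h =
      let r = posOf-edgeClosed d vd p i (trans (sym (posOfEdge-snoc e d p i edg)) h)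
      in trans (posOfEdge-vertex e d p) (proj₁ r) , trans (posOfEdge-vertex e d (p ++ [ i ])) (proj₂ r)
    posOfArgs-edgeClosed b ((e , d) ∷ cs) (ve , vd , vc) (suc x) p i h = posOfArgs-edgeClosed b cs vc x p i h

  mutual
    closed-of-edgeClosed : ∀ d → EdgeClosed (posOf d) → Closed d
    closed-of-edgeClosed hole c = tt
    closed-of-edgeClosed (node b cs) c = closedBelow-of-edgeClosed b cs (λ i h → c [] (suc i) h)
        (λ x p i h → c (suc x ∷ p) i h)

    closedBelow-of-edgeClosed : ∀ b cs →
        (∀ i → posOfArgs cs i ([] , edg) ≡ true → (b ≡ true) × (posOfArgs cs i ([] , vtx) ≡ true)) →
                (∀ x p i → posOfArgs cs x (p ++ [ i ] , edg) ≡ true →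
                   (posOfArgs cs x (p , vtx) ≡ true) × (posOfArgs cs x (p ++ [ i ] , vtx) ≡ true)) →
                ClosedBelow b cs
    closedBelow-of-edgeClosed b [] c0 c1 = tt
    closedBelow-of-edgeClosed b ((e , d) ∷ cs) c0 c1 =
      (λ h → proj₁ (c0 zero h) , trans (sym (posOf-rootVertex d)) (proj₂ (c0 zero h))) ,
      closed-of-edgeClosed d (λ p i h → let r = c1 zero p i (trans (posOfEdge-snoc e d p i edg) h)
                            in trans (sym (posOfEdge-vertex e d p)) (proj₁ r) ,
                               trans (sym (posOfEdge-vertex e d (p ++ [ i ]))) (proj₂ r)) ,
      closedBelow-of-edgeClosed b cs (λ i h → c0 (suc i) h) (λ x p i h → c1 (suc x) p i h)

  root-mono : ∀ {d d'} → d ≼ d' → root d ≤ root d'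
  root-mono {d' = d'} hole≼ = ≤-minimum (root d')
  root-mono (node≼ b≤b' _) = b≤b'

module GeometricClusters {F : Set} (ar : F → ℕ) where

  open import Defs
  open Decorations
  open Prelude using (∨-true-split; ∨-introˡ; ∨-introʳ; ∧-true-intro)
  open import Data.Nat using (ℕ; zero; suc)
  open import Data.Fin using (Fin; toℕ) renaming (zero to fz; suc to fs)
  open import Data.Vec using (Vec; []; _∷_; lookup)
  open import Data.Bool using (Bool; true; false; _∨_; _∧_; _≤_; f≤t; b≤b)
  open import Data.Bool.Properties using (∧-conicalˡ; ∧-conicalʳ)
  open import Data.List using (List; []; _∷_; [_]; map; cartesianProductWith; cartesianProduct)
  open import Data.List.Membership.Propositional using (_∈_)
  open import Data.List.Membership.Propositional.Properties using (∈-cartesianProductWith⁺; ∈-cartesianProduct⁺)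
  open import Data.List.Relation.Unary.Any as Any using (here; there)
  open import Data.List.Relation.Unary.Any.Properties using (map⁺)
  open import Data.Product as Product using (Σ; _×_; _,_; proj₁; proj₂)
  open import Data.Sum using ([_,_]′)
  open import Data.Unit using (⊤; tt)
  open import Data.Empty using (⊥; ⊥-elim)
  open import Function.Base using (_∘_)
  open import Relation.Binary.PropositionalEquality using (_≡_; refl; sym; trans; cong; _≢_; module ≡-Reasoning)
  open ≡-Reasoning

  T : Set
  T = Term ar

  mutual
    Fits : T → Deco → Set
    Fits (var k) hole = ⊤
    Fits (var k) (node _ _) = ⊥
    Fits (fun f ts) hole = ⊥
    Fits (fun f ts) (node b cs) = FitsArgs ts cs
    FitsArgs : ∀ {n} → Vec T n → List (Bool × Deco) → Set
    FitsArgs [] [] = ⊤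
    FitsArgs [] (_ ∷ _) = ⊥
    FitsArgs (t ∷ ts) [] = ⊥
    FitsArgs (t ∷ ts) ((e , d) ∷ cs) = Fits t d × FitsArgs ts cs

  ArgPos : ∀ {n} → Vec T n → ℕ → Pos → Set
  ArgPos [] i q = ⊥
  ArgPos (t ∷ ts) zero q = TreePos ar t q
  ArgPos (t ∷ ts) (suc i) q = ArgPos ts i q

  argPos-lookup : ∀ {n} (ts : Vec T n) j {q} → TreePos ar (lookup ts j) q → ArgPos ts (toℕ j) q
  argPos-lookup (t ∷ ts) fz h = h
  argPos-lookup (t ∷ ts) (fs j) h = argPos-lookup ts j h

  argPos-of-treePos : ∀ {f ts i p m} → TreePos ar (fun f ts) (suc i ∷ p , m) → ArgPos ts i (p , m)
  argPos-of-treePos {ts = ts} (child j h) = argPos-lookup ts j h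

  argPos-index : ∀ {n} (ts : Vec T n) i q → ArgPos ts i q → Σ (Fin n) λ j → (toℕ j ≡ i) × TreePos ar (lookup ts j) q
  argPos-index (t ∷ ts) zero q h = fz , refl , h
  argPos-index (t ∷ ts) (suc i) q h with argPos-index ts i q h
  ... | j , e , h' = fs j , cong suc e , h'

  treePos-of-argPos : ∀ {f ts i p m} → ArgPos ts i (p , m) → TreePos ar (fun f ts) (suc i ∷ p , m)
  treePos-of-argPos {f} {ts} {i} {p} {m} h with argPos-index ts i (p , m) h
  ... | j , refl , h' = child j h'

  dropChild : PosSet → PosSet
  dropChild S ([] , m) = false
  dropChild S (x ∷ p , m) = S (suc x ∷ p , m)

  firstChild : PosSet → PosSet
  firstChild S (p , m) = S (1 ∷ p , m)

  mutual
    decorate : T → PosSet → Deco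
    decorate (var k) S = hole
    decorate (fun f ts) S = node (S ([] , vtx)) (decorateArgs ts S)
    decorateArgs : ∀ {n} → Vec T n → PosSet → List (Bool × Deco)
    decorateArgs [] S = []
    decorateArgs (t ∷ ts) S = (S (1 ∷ [] , edg) , decorate t (firstChild S)) ∷ decorateArgs ts (dropChild S)

  mutual
    decorate-fits : ∀ t S → Fits t (decorate t S)
    decorate-fits (var k) S = tt
    decorate-fits (fun f ts) S = decorateArgs-fits ts S
    decorateArgs-fits : ∀ {n} (ts : Vec T n) S → FitsArgs ts (decorateArgs ts S)
    decorateArgs-fits [] S = tt
    decorateArgs-fits (t ∷ ts) S = decorate-fits t (firstChild S) , decorateArgs-fits ts (dropChild S)

  mutual
    posOf-decorate-internal : ∀ t S → (∀ q → S q ≡ true → TreePos ar t q) → ∀ q → q ≢ ([] , edg) →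
        posOf (decorate t S) q ≡ S q
    posOf-decorate-internal (var k) S inside q ne with S q in eq
    ... | false = refl
    ... | true with inside q eq
    ... | ()
    posOf-decorate-internal (fun f ts) S inside ([] , vtx) ne = refl
    posOf-decorate-internal (fun f ts) S inside ([] , edg) ne = ⊥-elim (ne refl)
    posOf-decorate-internal (fun f ts) S inside (zero ∷ p , m) ne with S (zero ∷ p , m) in eq
    ... | false = refl
    ... | true with inside _ eq
    ... | ()
    posOf-decorate-internal (fun f ts) S inside (suc i ∷ p , m) ne = posOfArgs-decorateArgs ts S
        (λ i p m h → argPos-of-treePos (inside _ h)) i p m

    posOfArgs-decorateArgs : ∀ {n} (ts : Vec T n) S → (∀ i p m → S (suc i ∷ p , m) ≡ true → ArgPos ts i (p , m)) →
          ∀ i p m → posOfArgs (decorateArgs ts S) i (p , m) ≡ S (suc i ∷ p , m)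
    posOfArgs-decorateArgs [] S inside i p m with S (suc i ∷ p , m) in eq
    ... | false = refl
    ... | true = ⊥-elim (inside i p m eq)
    posOfArgs-decorateArgs (t ∷ ts) S inside zero [] edg = refl
    posOfArgs-decorateArgs (t ∷ ts) S inside zero [] vtx = posOf-decorate-internal t (firstChild S)
        (λ { (p' , m') h → inside zero p' m' h }) ([] , vtx) (λ ())
    posOfArgs-decorateArgs (t ∷ ts) S inside zero (x ∷ p) m = posOf-decorate-internal t (firstChild S)
        (λ { (p' , m') h → inside zero p' m' h }) (x ∷ p , m) (λ ())
    posOfArgs-decorateArgs (t ∷ ts) S inside (suc i) p m = posOfArgs-decorateArgs ts (dropChild S)
        (λ i p m h → inside (suc i) p m h) i p m

  posOf-decorate : ∀ t S → GeomCluster ar t S → ∀ q → posOf (decorate t S) q ≡ S q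
  posOf-decorate t S g ([] , edg) with S ([] , edg) in eq
  ... | false = posOf-rootEdge (decorate t S)
  ... | true = ⊥-elim (proj₂ (GeomCluster.internal g _ eq) refl)
  posOf-decorate t S g ([] , vtx) = posOf-decorate-internal t S (λ q h → proj₁ (GeomCluster.internal g q h)) _ (λ ())
  posOf-decorate t S g (x ∷ p , m) = posOf-decorate-internal t S (λ q h → proj₁ (GeomCluster.internal g q h)) _ (λ ())

  decorate-closed : ∀ t S → GeomCluster ar t S → Closed (decorate t S)
  decorate-closed t S g = closed-of-edgeClosed (decorate t S) cl
    where
      e = posOf-decorate t S g
      cl : EdgeClosed (posOf (decorate t S))
      cl p i h = let r = GeomCluster.closed g p i (trans (sym (e _)) h)
                 in trans (e _) (proj₁ r) , trans (e _) (proj₂ r)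

  ≤ᵇ-of-⇒ : ∀ {b b'} → (b ≡ true → b' ≡ true) → b ≤ b'
  ≤ᵇ-of-⇒ {false} {false} h = b≤b
  ≤ᵇ-of-⇒ {false} {true} h = f≤t
  ≤ᵇ-of-⇒ {true} {true} h = b≤b
  ≤ᵇ-of-⇒ {true} {false} h with h refl
  ... | ()

  posOf-notRootEdge : ∀ d q → posOf d q ≡ true → q ≢ ([] , edg)
  posOf-notRootEdge d q x refl with trans (sym (posOf-rootEdge d)) x
  ... | ()

  mutual
    ≼-of-⊆ : ∀ t d d' → Fits t d → Fits t d' → (∀ q → posOf d q ≡ true → posOf d' q ≡ true) → d ≼ d'
    ≼-of-⊆ (var k) hole d' _ _ _ = hole≼
    ≼-of-⊆ (fun f ts) (node b cs) (node b' cs') fc fc' h =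
      node≼ (≤ᵇ-of-⇒ (h ([] , vtx))) (≼*-of-⊆ ts cs cs' fc fc' (λ i q → h (suc i ∷ proj₁ q , proj₂ q)))
    ≼*-of-⊆ : ∀ {n} (ts : Vec T n) cs cs' → FitsArgs ts cs → FitsArgs ts cs' →
          (∀ i q → posOfArgs cs i q ≡ true → posOfArgs cs' i q ≡ true) → cs ≼* cs'
    ≼*-of-⊆ [] [] [] _ _ _ = []≼
    ≼*-of-⊆ (t ∷ ts) ((e , d) ∷ cs) ((e' , d') ∷ cs') (fd , fc) (fd' , fc') h =
      ∷≼ (≤ᵇ-of-⇒ (h zero ([] , edg))) (≼-of-⊆ t d d' fd fd' h') (≼*-of-⊆ ts cs cs' fc fc' (λ i → h (suc i)))
      where
        h' : ∀ q → posOf d q ≡ true → posOf d' q ≡ true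
        h' q x = let ne = posOf-notRootEdge d q x in
                 trans (sym (posOfEdge-notRootEdge e' d' q ne)) (h zero q (trans (posOfEdge-notRootEdge e d q ne) x))

  rootEdge-of-root : ∀ t d → Fits t d → root d ≡ true → TreePos ar t ([] , edg)
  rootEdge-of-root (var k) hole f ()
  rootEdge-of-root (fun f ts) (node b cs) fc r = rootE

  mutual
    treePos-of-posOf : ∀ t d → Fits t d → Closed d → ∀ q → posOf d q ≡ true → TreePos ar t q
    treePos-of-posOf (var k) hole fc v q ()
    treePos-of-posOf (fun f ts) (node b cs) fc v ([] , vtx) h = rootV
    treePos-of-posOf (fun f ts) (node b cs) fc v ([] , edg) ()
    treePos-of-posOf (fun f ts) (node b cs) fc v (zero ∷ p , m) ()
    treePos-of-posOf (fun f ts) (node b cs) fc v (suc i ∷ p , m) h = treePos-of-argPos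
        (argPos-of-posOfArgs ts b cs fc v i (p , m) h)
    argPos-of-posOfArgs : ∀ {n} (ts : Vec T n) b cs → FitsArgs ts cs → ClosedBelow b cs → ∀ i q →
        posOfArgs cs i q ≡ true → ArgPos ts i q
    argPos-of-posOfArgs [] b [] _ _ i q ()
    argPos-of-posOfArgs (t ∷ ts) b ((e , d) ∷ cs) (fd , fc) (ve , vd , vc) zero ([] , edg) h = rootEdge-of-root t d fd
        (proj₂ (ve h))
    argPos-of-posOfArgs (t ∷ ts) b ((e , d) ∷ cs) (fd , fc) (ve , vd , vc) zero
        ([] , vtx) h = treePos-of-posOf t d fd vd ([] , vtx) h
    argPos-of-posOfArgs (t ∷ ts) b ((e , d) ∷ cs) (fd , fc) (ve , vd , vc) zero
        (x ∷ p , m) h = treePos-of-posOf t d fd vd _ h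
    argPos-of-posOfArgs (t ∷ ts) b ((e , d) ∷ cs) (fd , fc) (ve , vd , vc)
        (suc i) q h = argPos-of-posOfArgs ts b cs fc vc i q h

  geomCluster-posOf : ∀ t d → Fits t d → Closed d → GeomCluster ar t (posOf d)
  geomCluster-posOf t d fd vd = record
    { internal = λ q h → treePos-of-posOf t d fd vd q h , posOf-notRootEdge d q h
    ; closed = posOf-edgeClosed d vd }

  mutual
    normalize : Deco → Deco
    normalize hole = hole
    normalize (node b cs) = node b (normalizeArgs b cs)
    normalizeArgs : Bool → List (Bool × Deco) → List (Bool × Deco)
    normalizeArgs b [] = []
    normalizeArgs b ((e , d) ∷ cs) = (e ∧ (b ∧ root (normalize d)) , normalize d) ∷ normalizeArgs b cs

  mutual
    normalize-closed : ∀ d → Closed (normalize d)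
    normalize-closed hole = tt
    normalize-closed (node b cs) = normalizeArgs-closed b cs
    normalizeArgs-closed : ∀ b cs → ClosedBelow b (normalizeArgs b cs)
    normalizeArgs-closed b [] = tt
    normalizeArgs-closed b ((e , d) ∷ cs) =
      (λ h → let b∧r = ∧-conicalʳ e _ h in ∧-conicalˡ b _ b∧r , ∧-conicalʳ b _ b∧r) , normalize-closed d ,
          normalizeArgs-closed b cs

  mutual
    normalize-fits : ∀ t d → Fits t d → Fits t (normalize d)
    normalize-fits (var k) hole f = tt
    normalize-fits (fun f ts) (node b cs) fc = normalizeArgs-fits ts b cs fc
    normalizeArgs-fits : ∀ {n} (ts : Vec T n) b cs → FitsArgs ts cs → FitsArgs ts (normalizeArgs b cs)
    normalizeArgs-fits [] b [] f = tt
    normalizeArgs-fits (t ∷ ts) b ((e , d) ∷ cs) (fd , fc) = normalize-fits t d fd , normalizeArgs-fits ts b cs fc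

  mutual
    normalize-id : ∀ d → Closed d → normalize d ≡ d
    normalize-id hole v = refl
    normalize-id (node b cs) v = cong (node b) (normalizeArgs-id b cs v)
    normalizeArgs-id : ∀ b cs → ClosedBelow b cs → normalizeArgs b cs ≡ cs
    normalizeArgs-id b [] v = refl
    normalizeArgs-id b ((e , d) ∷ cs) (ve , vd , vc) rewrite normalize-id d vd | normalizeArgs-id b cs vc = cong
        (λ x → (x , d) ∷ cs) (lem e ve)
      where
        lem : ∀ e → (e ≡ true → b ≡ true × root d ≡ true) → e ∧ (b ∧ root d) ≡ e
        lem false h = refl
        lem true h rewrite proj₁ (h refl) | proj₂ (h refl) = refl

  mutual
    reshape : T → Deco → Deco
    reshape (var k) d = hole
    reshape (fun f ts) hole = node false (reshapeArgs ts [])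
    reshape (fun f ts) (node b cs) = node b (reshapeArgs ts cs)
    reshapeArgs : ∀ {n} → Vec T n → List (Bool × Deco) → List (Bool × Deco)
    reshapeArgs [] cs = []
    reshapeArgs (t ∷ ts) [] = (false , reshape t hole) ∷ reshapeArgs ts []
    reshapeArgs (t ∷ ts) ((e , d) ∷ cs) = (e , reshape t d) ∷ reshapeArgs ts cs

  mutual
    reshape-fits : ∀ t d → Fits t (reshape t d)
    reshape-fits (var k) d = tt
    reshape-fits (fun f ts) hole = reshapeArgs-fits ts []
    reshape-fits (fun f ts) (node b cs) = reshapeArgs-fits ts cs
    reshapeArgs-fits : ∀ {n} (ts : Vec T n) cs → FitsArgs ts (reshapeArgs ts cs)
    reshapeArgs-fits [] cs = tt
    reshapeArgs-fits (t ∷ ts) [] = reshape-fits t hole , reshapeArgs-fits ts []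
    reshapeArgs-fits (t ∷ ts) ((e , d) ∷ cs) = reshape-fits t d , reshapeArgs-fits ts cs

  mutual
    reshape-id : ∀ t d → Fits t d → reshape t d ≡ d
    reshape-id (var k) hole f = refl
    reshape-id (fun f ts) (node b cs) fc = cong (node b) (reshapeArgs-id ts cs fc)
    reshapeArgs-id : ∀ {n} (ts : Vec T n) cs → FitsArgs ts cs → reshapeArgs ts cs ≡ cs
    reshapeArgs-id [] [] f = refl
    reshapeArgs-id (t ∷ ts) ((e , d) ∷ cs) (fd , fc) rewrite reshape-id t d fd | reshapeArgs-id ts cs fc = refl

  bools : List Bool
  bools = true ∷ false ∷ []

  ∈bools : ∀ b → b ∈ bools
  ∈bools true = here refl
  ∈bools false = there (here refl)

  mutual
    decorations : T → List Deco
    decorations (var k) = [ hole ]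
    decorations (fun f ts) = cartesianProductWith node bools (argDecorations ts)
    argDecorations : ∀ {n} → Vec T n → List (List (Bool × Deco))
    argDecorations [] = [ [] ]
    argDecorations (t ∷ ts) = cartesianProductWith _∷_ (cartesianProduct bools (decorations t)) (argDecorations ts)

  mutual
    decorations-complete : ∀ t d → Fits t d → d ∈ decorations t
    decorations-complete (var k) hole f = here refl
    decorations-complete (fun f ts) (node b cs) fc = ∈-cartesianProductWith⁺ node (∈bools b)
        (argDecorations-complete ts cs fc)
    argDecorations-complete : ∀ {n} (ts : Vec T n) cs → FitsArgs ts cs → cs ∈ argDecorations ts
    argDecorations-complete [] [] f = here refl
    argDecorations-complete (t ∷ ts) ((e , d) ∷ cs) (fd , fc) =
      ∈-cartesianProductWith⁺ _∷_ (∈-cartesianProduct⁺ (∈bools e) (decorations-complete t d fd))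
          (argDecorations-complete ts cs fc)

  geomCluster-∪ : ∀ t {S S'} → GeomCluster ar t S → GeomCluster ar t S' → GeomCluster ar t (λ q → S q ∨ S' q)
  geomCluster-∪ t {S} {S'} g g' = record
    { internal = λ q h → [ GeomCluster.internal g q , GeomCluster.internal g' q ]′ (∨-true-split (S q) (S' q) h)
    ; closed   = λ p i h → [ Product.map (∨-introˡ _) (∨-introˡ _) ∘ GeomCluster.closed g p i
                           , Product.map (∨-introʳ _) (∨-introʳ _) ∘ GeomCluster.closed g' p i
                           ]′ (∨-true-split _ _ h)
    }

  geomCluster-∩ : ∀ t {S S'} → GeomCluster ar t S → GeomCluster ar t S' → GeomCluster ar t (λ q → S q ∧ S' q)
  geomCluster-∩ t g g' = record
    { internal = λ q h → GeomCluster.internal g q (∧-conicalˡ _ _ h)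
    ; closed   = λ p i h → Product.zip ∧-true-intro ∧-true-intro
                             (GeomCluster.closed g p i (∧-conicalˡ _ _ h))
                                 (GeomCluster.closed g' p i (∧-conicalʳ _ _ h))
    }

  clusterOf : ∀ t → Deco → GC ar t
  clusterOf t d = posOf (normalize (reshape t d)) , geomCluster-posOf t _ (normalize-fits t _ (reshape-fits t d))
      (normalize-closed (reshape t d))

  clusterOf-decorate : ∀ t (C : GC ar t) → _≈G_ ar {t} C (clusterOf t (decorate t (proj₁ C)))
  clusterOf-decorate t (S , g) = (λ q h → trans (eq q) h) , (λ q h → trans (sym (eq q)) h)
    where
      eq : ∀ q → posOf (normalize (reshape t (decorate t S))) q ≡ S q
      eq q = begin
        posOf (normalize (reshape t (decorate t S))) q
          ≡⟨ cong (λ d → posOf (normalize d) q) (reshape-id t (decorate t S) (decorate-fits t S)) ⟩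
        posOf (normalize (decorate t S)) q
          ≡⟨ cong (λ d → posOf d q) (normalize-id (decorate t S) (decorate-closed t S g)) ⟩
        posOf (decorate t S) q
          ≡⟨ posOf-decorate t S g q ⟩
        S q ∎

  geomClusters-finite : ∀ t → FiniteUpTo (_≈G_ ar {t})
  geomClusters-finite t = map (clusterOf t) (decorations t) , λ C →
    map⁺ (Any.map (λ { refl → clusterOf-decorate t C }) (decorations-complete t _ (decorate-fits t (proj₁ C))))

module ClusterDecorations {F : Set} (ar : F → ℕ) where

  open import Defs
  open Decorations
  open GeometricClusters ar
  open import Data.Nat using (ℕ; zero; suc)
  open import Data.Vec using (Vec; []; _∷_)
  open import Data.Bool using (Bool; true; false; _≤_; f≤t; b≤b)
  open import Data.Bool.Properties using (≤-minimum)
  open import Data.List using (List; []; _∷_)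
  open import Data.List.Membership.Propositional using (_∈_)
  open import Data.List.Membership.Propositional.Properties using (∈-++⁺ˡ; ∈-++⁺ʳ)
  open import Data.List.Relation.Unary.Any using (here; there)
  open import Data.Product using (_×_; _,_; proj₂)
  open import Data.Unit using (tt)
  open import Relation.Binary.PropositionalEquality using (_≡_; refl; sym; trans; cong; cong₂; subst; subst₂)

  Sk : Set
  Sk = Skel ar

  Gap : Set
  Gap = GapVar ar

  arg : ∀ {n} → Vec Sk n → ℕ → Sk
  arg ss k = lookupℕ ss k (svar k)

  isFun : T → Bool
  isFun (var _) = false
  isFun (fun _ _) = true

  mutual
    inst : T → (ℕ → T) → T
    inst (var k) σ = σ k
    inst (fun f us) σ = fun f (insts us σ)
    insts : ∀ {n} → Vec T n → (ℕ → T) → Vec T n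
    insts [] σ = []
    insts (u ∷ us) σ = inst u σ ∷ insts us σ

  mutual
    instT≡inst : ∀ {n} u (σ : Vec T n) → instT ar u σ ≡ inst u (λ k → lookupℕ σ k (var k))
    instT≡inst (var k) σ = refl
    instT≡inst (fun f us) σ = cong (fun f) (instTs≡insts us σ)
    instTs≡insts : ∀ {n m} (us : Vec T m) (σ : Vec T n) → instTs ar us σ ≡ insts us (λ k → lookupℕ σ k (var k))
    instTs≡insts [] σ = refl
    instTs≡insts (u ∷ us) σ = cong₂ _∷_ (instT≡inst u σ) (instTs≡insts us σ)

  mutual
    instSk : Sk → (ℕ → Sk) → Sk
    instSk (svar k) σ = σ k
    instSk (sfun f ss) σ = sfun f (instSks ss σ)
    instSk (sgap Z ss) σ = sgap Z (instSks ss σ)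
    instSks : ∀ {n} → Vec Sk n → (ℕ → Sk) → Vec Sk n
    instSks [] σ = []
    instSks (s ∷ ss) σ = instSk s σ ∷ instSks ss σ

  mutual
    instS≡instSk : ∀ {n} g (σ : Vec Sk n) → instS ar g σ ≡ instSk g (arg σ)
    instS≡instSk (svar k) σ = refl
    instS≡instSk (sfun f ss) σ = cong (sfun f) (instSs≡instSks ss σ)
    instS≡instSk (sgap Z ss) σ = cong (sgap Z) (instSs≡instSks ss σ)
    instSs≡instSks : ∀ {n m} (ss : Vec Sk m) (σ : Vec Sk n) → instSs ar ss σ ≡ instSks ss (arg σ)
    instSs≡instSks [] σ = refl
    instSs≡instSks (s ∷ ss) σ = cong₂ _∷_ (instS≡instSk s σ) (instSs≡instSks ss σ)

  lookupℕ-soTs : ∀ {n} (α : Gap → T) (ss : Vec Sk n) k j → lookupℕ (soTs ar α ss) k (var j) ≡ soT ar α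
      (lookupℕ ss k (svar j))
  lookupℕ-soTs α [] k j = refl
  lookupℕ-soTs α (s ∷ ss) zero j = refl
  lookupℕ-soTs α (s ∷ ss) (suc k) j = lookupℕ-soTs α ss k j

  arg-soTs : ∀ {n} (α : Gap → T) (ss : Vec Sk n) k → lookupℕ (soTs ar α ss) k (var k) ≡ soT ar α (arg ss k)
  arg-soTs α ss k = lookupℕ-soTs α ss k k

  mutual
    inst-ext : ∀ u {σ σ'} → (∀ k → σ k ≡ σ' k) → inst u σ ≡ inst u σ'
    inst-ext (var k) e = e k
    inst-ext (fun f us) e = cong (fun f) (insts-ext us e)
    insts-ext : ∀ {n} (us : Vec T n) {σ σ'} → (∀ k → σ k ≡ σ' k) → insts us σ ≡ insts us σ'
    insts-ext [] e = refl
    insts-ext (u ∷ us) e = cong₂ _∷_ (inst-ext u e) (insts-ext us e)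

  mutual
    instSk-ext : ∀ u {σ σ' : ℕ → Sk} → (∀ k → σ k ≡ σ' k) → instSk u σ ≡ instSk u σ'
    instSk-ext (svar k) e = e k
    instSk-ext (sfun f us) e = cong (sfun f) (instSks-ext us e)
    instSk-ext (sgap Z us) e = cong (sgap Z) (instSks-ext us e)
    instSks-ext : ∀ {n} (us : Vec Sk n) {σ σ' : ℕ → Sk} → (∀ k → σ k ≡ σ' k) → instSks us σ ≡ instSks us σ'
    instSks-ext [] e = refl
    instSks-ext (u ∷ us) e = cong₂ _∷_ (instSk-ext u e) (instSks-ext us e)

  soT-sgap : ∀ (α : Gap → T) Z (ss : Vec Sk (proj₂ Z)) → soT ar α (sgap Z ss) ≡ inst (α Z) (λ k → soT ar α (arg ss k))
  soT-sgap α Z ss = trans (instT≡inst (α Z) (soTs ar α ss)) (inst-ext (α Z) (arg-soTs α ss))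

  lookupℕ-soSs : ∀ {n} (γ : Gap → Sk) (ss : Vec Sk n) k j → lookupℕ (soSs ar γ ss) k (svar j) ≡ soS ar γ
      (lookupℕ ss k (svar j))
  lookupℕ-soSs γ [] k j = refl
  lookupℕ-soSs γ (s ∷ ss) zero j = refl
  lookupℕ-soSs γ (s ∷ ss) (suc k) j = lookupℕ-soSs γ ss k j

  arg-soSs : ∀ {n} (γ : Gap → Sk) (ss : Vec Sk n) k → arg (soSs ar γ ss) k ≡ soS ar γ (arg ss k)
  arg-soSs γ ss k = lookupℕ-soSs γ ss k k

  soS-sgap : ∀ (γ : Gap → Sk) Z (ss : Vec Sk (proj₂ Z)) → soS ar γ (sgap Z ss) ≡ instSk (γ Z)
      (λ k → soS ar γ (arg ss k))
  soS-sgap γ Z ss = trans (instS≡instSk (γ Z) (soSs ar γ ss)) (instSk-ext (γ Z) (arg-soSs γ ss))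

  -- The decoration of an inductive cluster (M , α) marks the inside of the patterns:
  -- all vertices and edges of α Z except the edges leading to its variables, which
  -- remain as unmarked edges into the surrounding skeleton (`deco` of `svar`/`sfun`).
  mutual
    patDeco : T → (ℕ → Deco) → Deco
    patDeco (var k) e = e k
    patDeco (fun f us) e = node true (patDecoArgs us e)
    patDecoArgs : ∀ {n} → Vec T n → (ℕ → Deco) → List (Bool × Deco)
    patDecoArgs [] e = []
    patDecoArgs (u ∷ us) e = (isFun u , patDeco u e) ∷ patDecoArgs us e

  mutual
    deco : (Gap → T) → Sk → Deco
    deco α (svar k) = hole
    deco α (sfun f ss) = node false (decoArgs α ss)
    deco α (sgap Z ss) = patDeco (α Z) (nthDeco (decoList α ss))
    decoArgs : ∀ {n} → (Gap → T) → Vec Sk n → List (Bool × Deco)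
    decoArgs α [] = []
    decoArgs α (s ∷ ss) = (false , deco α s) ∷ decoArgs α ss
    decoList : ∀ {n} → (Gap → T) → Vec Sk n → List Deco
    decoList α [] = []
    decoList α (s ∷ ss) = deco α s ∷ decoList α ss

  nthDeco-decoList′ : ∀ {n} α (ss : Vec Sk n) k j → nthDeco (decoList α ss) k ≡ deco α (lookupℕ ss k (svar j))
  nthDeco-decoList′ α [] k j = refl
  nthDeco-decoList′ α (s ∷ ss) zero j = refl
  nthDeco-decoList′ α (s ∷ ss) (suc k) j = nthDeco-decoList′ α ss k j

  nthDeco-decoList : ∀ {n} α (ss : Vec Sk n) k → nthDeco (decoList α ss) k ≡ deco α (arg ss k)
  nthDeco-decoList α ss k = nthDeco-decoList′ α ss k k

  mutual
    patDeco-ext : ∀ u {e e'} → (∀ k → e k ≡ e' k) → patDeco u e ≡ patDeco u e'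
    patDeco-ext (var k) h = h k
    patDeco-ext (fun f us) h = cong (node true) (patDecoArgs-ext us h)
    patDecoArgs-ext : ∀ {n} (us : Vec T n) {e e'} → (∀ k → e k ≡ e' k) → patDecoArgs us e ≡ patDecoArgs us e'
    patDecoArgs-ext [] h = refl
    patDecoArgs-ext (u ∷ us) h = cong₂ (λ a b → (isFun u , a) ∷ b) (patDeco-ext u h) (patDecoArgs-ext us h)

  deco-sgap : ∀ α Z (ss : Vec Sk (proj₂ Z)) → deco α (sgap Z ss) ≡ patDeco (α Z) (λ k → deco α (arg ss k))
  deco-sgap α Z ss = patDeco-ext (α Z) (nthDeco-decoList α ss)

  mutual
    patDeco-fits : ∀ p {σ e} → (∀ k → Fits (σ k) (e k)) → Fits (inst p σ) (patDeco p e)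
    patDeco-fits (var k) h = h k
    patDeco-fits (fun f us) h = patDecoArgs-fits us h
    patDecoArgs-fits : ∀ {n} (us : Vec T n) {σ e} → (∀ k → Fits (σ k) (e k)) → FitsArgs (insts us σ) (patDecoArgs us e)
    patDecoArgs-fits [] h = tt
    patDecoArgs-fits (u ∷ us) h = patDeco-fits u h , patDecoArgs-fits us h

  mutual
    deco-fits : ∀ α M → Fits (soT ar α M) (deco α M)
    deco-fits α (svar k) = tt
    deco-fits α (sfun f ss) = decoArgs-fits α ss
    deco-fits α (sgap Z ss) = subst (λ x → Fits x (deco α (sgap Z ss))) (sym (soT-sgap α Z ss))
                           (subst (Fits (inst (α Z) (λ k → soT ar α (arg ss k)))) (sym (deco-sgap α Z ss))
                             (patDeco-fits (α Z) {λ k → soT ar α (arg ss k)} {λ k → deco α (arg ss k)}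
                                 (decoList-fits α ss)))
    decoArgs-fits : ∀ {n} α (ss : Vec Sk n) → FitsArgs (soTs ar α ss) (decoArgs α ss)
    decoArgs-fits α [] = tt
    decoArgs-fits α (s ∷ ss) = deco-fits α s , decoArgs-fits α ss
    decoList-fits : ∀ {n} α (ss : Vec Sk n) k → Fits (soT ar α (arg ss k)) (deco α (arg ss k))
    decoList-fits α ss k = decoList-fits′ α ss k k
    decoList-fits′ : ∀ {n} α (ss : Vec Sk n) k j → Fits (soT ar α (lookupℕ ss k (svar j)))
        (deco α (lookupℕ ss k (svar j)))
    decoList-fits′ α [] k j = tt
    decoList-fits′ α (s ∷ ss) zero j = deco-fits α s
    decoList-fits′ α (s ∷ ss) (suc k) j = decoList-fits′ α ss k j

  root-patDeco : ∀ u e → isFun u ≡ true → root (patDeco u e) ≡ true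
  root-patDeco (fun f us) e h = refl

  mutual
    patDeco-closed : ∀ p {e} → (∀ k → Closed (e k)) → Closed (patDeco p e)
    patDeco-closed (var k) h = h k
    patDeco-closed (fun f us) h = patDecoArgs-closed us h
    patDecoArgs-closed : ∀ {n} (us : Vec T n) {e} → (∀ k → Closed (e k)) → ClosedBelow true (patDecoArgs us e)
    patDecoArgs-closed [] h = tt
    patDecoArgs-closed (u ∷ us) {e} h = (λ x → refl , root-patDeco u e x) , patDeco-closed u h , patDecoArgs-closed us h

  mutual
    deco-closed : ∀ α M → Closed (deco α M)
    deco-closed α (svar k) = tt
    deco-closed α (sfun f ss) = decoArgs-closed α ss
    deco-closed α (sgap Z ss) = patDeco-closed (α Z)
        (λ k → subst Closed (sym (nthDeco-decoList α ss k)) (decoList-closed α ss k))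
    decoArgs-closed : ∀ {n} α (ss : Vec Sk n) → ClosedBelow false (decoArgs α ss)
    decoArgs-closed α [] = tt
    decoArgs-closed α (s ∷ ss) = (λ ()) , deco-closed α s , decoArgs-closed α ss
    decoList-closed : ∀ {n} α (ss : Vec Sk n) k → Closed (deco α (arg ss k))
    decoList-closed α ss k = decoList-closed′ α ss k k
    decoList-closed′ : ∀ {n} α (ss : Vec Sk n) k j → Closed (deco α (lookupℕ ss k (svar j)))
    decoList-closed′ α [] k j = tt
    decoList-closed′ α (s ∷ ss) zero j = deco-closed α s
    decoList-closed′ α (s ∷ ss) (suc k) j = decoList-closed′ α ss k j

  isFun-inst : ∀ p σ → isFun p ≤ isFun (inst p σ)
  isFun-inst (var k) σ with σ k
  ... | var _ = b≤b
  ... | fun _ _ = f≤t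
  isFun-inst (fun f us) σ = b≤b

  clusterDeco : ∀ {t} → IC ar t → Deco
  clusterDeco ((M , α) , _) = deco α M

  mutual
    patDeco-≼-inst : ∀ p σ {e1 e} → (∀ k → e1 k ≼ patDeco (σ k) e) → patDeco p e1 ≼ patDeco (inst p σ) e
    patDeco-≼-inst (var k) σ h = h k
    patDeco-≼-inst (fun f us) σ h = node≼ b≤b (patDecoArgs-≼-inst us σ h)
    patDecoArgs-≼-inst : ∀ {n} (us : Vec T n) σ {e1 e} → (∀ k → e1 k ≼ patDeco (σ k) e) →
        patDecoArgs us e1 ≼* patDecoArgs (insts us σ) e
    patDecoArgs-≼-inst [] σ h = []≼
    patDecoArgs-≼-inst (u ∷ us) σ h = ∷≼ (isFun-inst u σ) (patDeco-≼-inst u σ h) (patDecoArgs-≼-inst us σ h)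

  module _ (α : Gap → T) where
    mutual
      deco-instSk-≼ : ∀ g (ξ : ℕ → Sk) (e : ℕ → Deco) → (∀ k → deco α (ξ k) ≼ e k) →
          deco α (instSk g ξ) ≼ patDeco (soT ar α g) e
      deco-instSk-≼ (svar k) ξ e h = h k
      deco-instSk-≼ (sfun f hs) ξ e h = node≼ f≤t (decoArgs-instSk-≼ hs ξ e h)
      deco-instSk-≼ (sgap Y hs) ξ e h = subst (λ x → deco α (sgap Y (instSks hs ξ)) ≼ patDeco x e)
          (sym (soT-sgap α Y hs))
                              (patDeco-≼-inst (α Y) (λ k → soT ar α (arg hs k)) (decoList-instSk-≼ hs ξ e h))
      decoArgs-instSk-≼ : ∀ {n} (hs : Vec Sk n) ξ e → (∀ k → deco α (ξ k) ≼ e k) →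
          decoArgs α (instSks hs ξ) ≼* patDecoArgs (soTs ar α hs) e
      decoArgs-instSk-≼ [] ξ e h = []≼
      decoArgs-instSk-≼ (g ∷ hs) ξ e h = ∷≼ (≤-minimum _) (deco-instSk-≼ g ξ e h) (decoArgs-instSk-≼ hs ξ e h)
      decoList-instSk-≼ : ∀ {n} (hs : Vec Sk n) ξ e → (∀ k → deco α (ξ k) ≼ e k) → ∀ k →
          nthDeco (decoList α (instSks hs ξ)) k ≼ patDeco (soT ar α (arg hs k)) e
      decoList-instSk-≼ hs ξ e h k = decoList-instSk-≼′ hs ξ e h k k
      decoList-instSk-≼′ : ∀ {n} (hs : Vec Sk n) ξ e → (∀ k → deco α (ξ k) ≼ e k) → ∀ k j →
          nthDeco (decoList α (instSks hs ξ)) k ≼ patDeco (soT ar α (lookupℕ hs k (svar j))) e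
      decoList-instSk-≼′ [] ξ e h k j = hole≼
      decoList-instSk-≼′ (g ∷ hs) ξ e h zero j = deco-instSk-≼ g ξ e h
      decoList-instSk-≼′ (g ∷ hs) ξ e h (suc k) j = decoList-instSk-≼′ hs ξ e h k j

    mutual
      deco-refine-≼ : ∀ (β : Gap → T) (γ : Gap → Sk) N → (∀ Z → Z ∈ gapsOf ar N → β Z ≡ soT ar α (γ Z)) →
            deco α (soS ar γ N) ≼ deco β N
      deco-refine-≼ β γ (svar k) β≡ = hole≼
      deco-refine-≼ β γ (sfun f ns) β≡ = node≼ b≤b (decoArgs-refine-≼ β γ ns β≡)
      deco-refine-≼ β γ (sgap Z ns) β≡ =
        subst₂ _≼_ (sym (cong (deco α) (soS-sgap γ Z ns))) (sym (deco-sgap β Z ns))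
          (subst (λ x → deco α (instSk (γ Z) (λ k → soS ar γ (arg ns k))) ≼ patDeco x (λ k → deco β (arg ns k)))
              (sym (β≡ Z (here refl)))
            (deco-instSk-≼ (γ Z) (λ k → soS ar γ (arg ns k)) (λ k → deco β (arg ns k))
                (decoList-refine-≼ β γ ns (λ Z' m → β≡ Z' (there m)))))
      decoArgs-refine-≼ : ∀ {n} (β : Gap → T) (γ : Gap → Sk) (ns : Vec Sk n) →
          (∀ Z → Z ∈ gapsOfs ar ns → β Z ≡ soT ar α (γ Z)) →
             decoArgs α (soSs ar γ ns) ≼* decoArgs β ns
      decoArgs-refine-≼ β γ [] β≡ = []≼
      decoArgs-refine-≼ β γ (n ∷ ns) β≡ = ∷≼ b≤b (deco-refine-≼ β γ n (λ Z m → β≡ Z (∈-++⁺ˡ m)))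
          (decoArgs-refine-≼ β γ ns (λ Z m → β≡ Z (∈-++⁺ʳ _ m)))
      decoList-refine-≼ : ∀ {n} (β : Gap → T) (γ : Gap → Sk) (ns : Vec Sk n) →
          (∀ Z → Z ∈ gapsOfs ar ns → β Z ≡ soT ar α (γ Z)) →
             ∀ k → deco α (soS ar γ (arg ns k)) ≼ deco β (arg ns k)
      decoList-refine-≼ β γ ns β≡ k = decoList-refine-≼′ β γ ns β≡ k k
      decoList-refine-≼′ : ∀ {n} (β : Gap → T) (γ : Gap → Sk) (ns : Vec Sk n) →
          (∀ Z → Z ∈ gapsOfs ar ns → β Z ≡ soT ar α (γ Z)) →
             ∀ k j → deco α (soS ar γ (lookupℕ ns k (svar j))) ≼ deco β (lookupℕ ns k (svar j))
      decoList-refine-≼′ β γ [] β≡ k j = hole≼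
      decoList-refine-≼′ β γ (n ∷ ns) β≡ zero j = deco-refine-≼ β γ n (λ Z m → β≡ Z (∈-++⁺ˡ m))
      decoList-refine-≼′ β γ (n ∷ ns) β≡ (suc k) j = decoList-refine-≼′ β γ ns (λ Z m → β≡ Z (∈-++⁺ʳ _ m)) k j

  mutual
    deco-renS : ∀ (α β : Gap → T) ρ M → (∀ Z → Z ∈ gapsOf ar M → β (renG ar ρ Z) ≡ α Z) →
        deco β (renS ar ρ M) ≡ deco α M
    deco-renS α β ρ (svar k) h = refl
    deco-renS α β ρ (sfun f ss) h = cong (node false) (decoArgs-renS α β ρ ss h)
    deco-renS α β ρ (sgap Z ss) h =
      trans (cong (λ z → patDeco z (nthDeco (decoList β (renSs ar ρ ss)))) (h Z (here refl)))
            (cong (λ l → patDeco (α Z) (nthDeco l)) (decoList-renS α β ρ ss (λ Z' m → h Z' (there m))))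
    decoArgs-renS : ∀ {n} (α β : Gap → T) ρ (ss : Vec Sk n) → (∀ Z → Z ∈ gapsOfs ar ss → β (renG ar ρ Z) ≡ α Z) →
        decoArgs β (renSs ar ρ ss) ≡ decoArgs α ss
    decoArgs-renS α β ρ [] h = refl
    decoArgs-renS α β ρ (s ∷ ss) h = cong₂ (λ a b → (false , a) ∷ b) (deco-renS α β ρ s (λ Z m → h Z (∈-++⁺ˡ m)))
        (decoArgs-renS α β ρ ss (λ Z m → h Z (∈-++⁺ʳ _ m)))
    decoList-renS : ∀ {n} (α β : Gap → T) ρ (ss : Vec Sk n) → (∀ Z → Z ∈ gapsOfs ar ss → β (renG ar ρ Z) ≡ α Z) →
        decoList β (renSs ar ρ ss) ≡ decoList α ss
    decoList-renS α β ρ [] h = refl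
    decoList-renS α β ρ (s ∷ ss) h = cong₂ _∷_ (deco-renS α β ρ s (λ Z m → h Z (∈-++⁺ˡ m)))
        (decoList-renS α β ρ ss (λ Z m → h Z (∈-++⁺ʳ _ m)))

module CanonicalClusters {F : Set} (ar : F → ℕ) where

  open import Defs
  open Decorations
  open Prelude
  open GeometricClusters ar
  open ClusterDecorations ar
  open import Data.Nat using (ℕ; suc; _+_; _≤_)
  open import Data.Nat.Properties using (+-suc; ≤-refl; ≤-trans; n≤1+n; <-irrefl; +-identityʳ)
  open import Data.Vec using (Vec; []; _∷_; fromList)
  open import Data.Bool using (Bool; true; false)
  open import Data.List using (List; []; _∷_; _++_; [_]; length)
  open import Data.List.Properties using (length-++; ++-assoc)
  open import Data.List.Membership.Propositional using (_∈_)
  open import Data.List.Relation.Unary.Any using (here; there)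
  open import Data.List.Relation.Unary.All as All using (All; []; _∷_)
  import Data.List.Relation.Unary.All.Properties as AllP
  open import Data.List.Relation.Unary.AllPairs using ([]; _∷_)
  open import Data.List.Relation.Unary.Unique.Propositional using (Unique)
  open import Data.Product using (_×_; _,_; proj₁; proj₂)
  open import Relation.Binary.PropositionalEquality using (_≡_; refl; sym; trans; cong; cong₂; subst)

  record Regions (n : ℕ) : Set where
    constructor mkRegions
    field
      tops : Vec T n
      holes : List Sk
      gapPats : List (ℕ × T)
  open Regions

  record Region : Set where
    constructor mkRegion
    field
      top : T
      holes₁ : List Sk
      gapPats₁ : List (ℕ × T)
  open Region

  sgapL : ℕ → List Sk → Sk
  sgapL s a = sgap (s , length a) (fromList a)

  -- `carve t d s` is the canonical inductive cluster of a closed decoration d of t: each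
  -- maximal connected marked region becomes one gap, numbered from s, and the list records
  -- (arity, pattern) of the gaps in order. Below a marked vertex, `regionArgs` collects the
  -- pattern of the region (variables numbered from k), the skeletons hanging below it and
  -- the gaps inside those.
  mutual
    carve : T → Deco → ℕ → Sk × List (ℕ × T)
    carve (var k) d s = svar k , []
    carve (fun f ts) hole s = svar 0 , []
    carve (fun f ts) (node false cs) s = sfun f (proj₁ (carveArgs ts cs s)) , proj₂ (carveArgs ts cs s)
    carve (fun f ts) (node true cs) s = sgapL s (holes R) , (length (holes R) , fun f (tops R)) ∷ gapPats R
      where R = regionArgs ts cs 0 (suc s)
    carveArgs : ∀ {n} → Vec T n → List (Bool × Deco) → ℕ → Vec Sk n × List (ℕ × T)
    carveArgs [] cs s = [] , []
    carveArgs (t ∷ ts) [] s = svar 0 ∷ proj₁ (carveArgs ts [] s) , proj₂ (carveArgs ts [] s)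
    carveArgs (t ∷ ts) ((e , d) ∷ cs) s = proj₁ C ∷ proj₁ Cs , proj₂ C ++ proj₂ Cs
      where C  = carve t d s
            Cs = carveArgs ts cs (s + length (proj₂ C))
    regionArgs : ∀ {n} → Vec T n → List (Bool × Deco) → ℕ → ℕ → Regions n
    regionArgs [] cs k s = mkRegions [] [] []
    regionArgs (t ∷ ts) [] k s = mkRegions (var k ∷ tops R) (svar 0 ∷ holes R) (gapPats R)
      where R = regionArgs ts [] (suc k) s
    regionArgs (t ∷ ts) ((true , d) ∷ cs) k s = mkRegions (top r ∷ tops R) (holes₁ r ++ holes R)
        (gapPats₁ r ++ gapPats R)
      where r = region t d k s
            R = regionArgs ts cs (k + length (holes₁ r)) (s + length (gapPats₁ r))
    regionArgs (t ∷ ts) ((false , d) ∷ cs) k s = mkRegions (var k ∷ tops R) (proj₁ C ∷ holes R) (proj₂ C ++ gapPats R)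
      where C = carve t d s
            R = regionArgs ts cs (suc k) (s + length (proj₂ C))
    region : T → Deco → ℕ → ℕ → Region
    region (var x) d k s = mkRegion (var k) [ svar 0 ] []
    region (fun f ts) hole k s = mkRegion (var k) [ svar 0 ] []
    region (fun f ts) (node b cs) k s = mkRegion (fun f (tops (regionArgs ts cs k s))) (holes (regionArgs ts cs k s))
        (gapPats (regionArgs ts cs k s))

  gapsFrom : ℕ → List (ℕ × T) → List Gap
  gapsFrom s [] = []
  gapsFrom s ((a , ℓ) ∷ ps) = (s , a) ∷ gapsFrom (suc s) ps

  gapsFrom-++ : ∀ s (p1 p2 : List (ℕ × T)) → gapsFrom s (p1 ++ p2) ≡ gapsFrom s p1 ++ gapsFrom (s + length p1) p2
  gapsFrom-++ s [] p2 = cong (λ z → gapsFrom z p2) (sym (+-identityʳ s))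
  gapsFrom-++ s ((a , ℓ) ∷ p1) p2 = cong ((s , a) ∷_)
      (trans (gapsFrom-++ (suc s) p1 p2)
          (cong (λ z → gapsFrom (suc s) p1 ++ gapsFrom z p2) (sym (+-suc s (length p1)))))

  gapsOfList : List Sk → List Gap
  gapsOfList [] = []
  gapsOfList (m ∷ ms) = gapsOf ar m ++ gapsOfList ms

  gapsOfList-++ : ∀ (a b : List Sk) → gapsOfList (a ++ b) ≡ gapsOfList a ++ gapsOfList b
  gapsOfList-++ [] b = refl
  gapsOfList-++ (m ∷ a) b = trans (cong (gapsOf ar m ++_) (gapsOfList-++ a b))
      (sym (++-assoc (gapsOf ar m) (gapsOfList a) (gapsOfList b)))

  gapsOfs-fromList : ∀ (a : List Sk) → gapsOfs ar (fromList a) ≡ gapsOfList a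
  gapsOfs-fromList [] = refl
  gapsOfs-fromList (m ∷ a) = cong (gapsOf ar m ++_) (gapsOfs-fromList a)

  mutual
    carve-gaps : ∀ t d s → gapsOf ar (proj₁ (carve t d s)) ≡ gapsFrom s (proj₂ (carve t d s))
    carve-gaps (var k) d s = refl
    carve-gaps (fun f ts) hole s = refl
    carve-gaps (fun f ts) (node false cs) s = carveArgs-gaps ts cs s
    carve-gaps (fun f ts) (node true cs) s =
      cong ((s , length (holes (regionArgs ts cs 0 (suc s)))) ∷_)
          (trans (gapsOfs-fromList (holes (regionArgs ts cs 0 (suc s)))) (regionArgs-gaps ts cs 0 (suc s)))
    carveArgs-gaps : ∀ {n} (ts : Vec T n) cs s → gapsOfs ar (proj₁ (carveArgs ts cs s)) ≡ gapsFrom s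
        (proj₂ (carveArgs ts cs s))
    carveArgs-gaps [] cs s = refl
    carveArgs-gaps (t ∷ ts) [] s = carveArgs-gaps ts [] s
    carveArgs-gaps (t ∷ ts) ((e , d) ∷ cs) s =
      trans (cong₂ _++_ (carve-gaps t d s) (carveArgs-gaps ts cs _)) (sym (gapsFrom-++ s (proj₂ (carve t d s)) _))
    regionArgs-gaps : ∀ {n} (ts : Vec T n) cs k s → gapsOfList (holes (regionArgs ts cs k s)) ≡ gapsFrom s
        (gapPats (regionArgs ts cs k s))
    regionArgs-gaps [] cs k s = refl
    regionArgs-gaps (t ∷ ts) [] k s = regionArgs-gaps ts [] (suc k) s
    regionArgs-gaps (t ∷ ts) ((true , d) ∷ cs) k s =
      trans (gapsOfList-++ (holes₁ (region t d k s)) _)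
        (trans (cong₂ _++_ (region-gaps t d k s) (regionArgs-gaps ts cs _ _))
            (sym (gapsFrom-++ s (gapPats₁ (region t d k s)) _)))
    regionArgs-gaps (t ∷ ts) ((false , d) ∷ cs) k s =
      trans (cong₂ _++_ (carve-gaps t d s) (regionArgs-gaps ts cs _ _)) (sym (gapsFrom-++ s (proj₂ (carve t d s)) _))
    region-gaps : ∀ t d k s → gapsOfList (holes₁ (region t d k s)) ≡ gapsFrom s (gapPats₁ (region t d k s))
    region-gaps (var x) d k s = refl
    region-gaps (fun f ts) hole k s = refl
    region-gaps (fun f ts) (node b cs) k s = regionArgs-gaps ts cs k s

  IsPattern : ℕ × T → Set
  IsPattern p = Pattern ar (proj₁ p) (proj₂ p)

  mutual
    carve-patterns : ∀ t d s → All IsPattern (proj₂ (carve t d s))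
    carve-patterns (var k) d s = []
    carve-patterns (fun f ts) hole s = []
    carve-patterns (fun f ts) (node false cs) s = carveArgs-patterns ts cs s
    carve-patterns (fun f ts) (node true cs) s =
      ((λ ()) , trans (regionArgs-vars ts cs 0 (suc s)) (sym (upTo-interval _))) ∷ regionArgs-patterns ts cs 0 (suc s)
    carveArgs-patterns : ∀ {n} (ts : Vec T n) cs s → All IsPattern (proj₂ (carveArgs ts cs s))
    carveArgs-patterns [] cs s = []
    carveArgs-patterns (t ∷ ts) [] s = carveArgs-patterns ts [] s
    carveArgs-patterns (t ∷ ts) ((e , d) ∷ cs) s = AllP.++⁺ (carve-patterns t d s) (carveArgs-patterns ts cs _)
    regionArgs-patterns : ∀ {n} (ts : Vec T n) cs k s → All IsPattern (gapPats (regionArgs ts cs k s))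
    regionArgs-patterns [] cs k s = []
    regionArgs-patterns (t ∷ ts) [] k s = regionArgs-patterns ts [] (suc k) s
    regionArgs-patterns (t ∷ ts) ((true , d) ∷ cs) k s = AllP.++⁺ (region-patterns t d k s)
        (regionArgs-patterns ts cs _ _)
    regionArgs-patterns (t ∷ ts) ((false , d) ∷ cs) k s = AllP.++⁺ (carve-patterns t d s)
        (regionArgs-patterns ts cs _ _)
    region-patterns : ∀ t d k s → All IsPattern (gapPats₁ (region t d k s))
    region-patterns (var x) d k s = []
    region-patterns (fun f ts) hole k s = []
    region-patterns (fun f ts) (node b cs) k s = regionArgs-patterns ts cs k s

    regionArgs-vars : ∀ {n} (ts : Vec T n) cs k s → varsOfs ar (⌜_⌝s ar (tops (regionArgs ts cs k s))) ≡ interval k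
        (length (holes (regionArgs ts cs k s)))
    regionArgs-vars [] cs k s = refl
    regionArgs-vars (t ∷ ts) [] k s = cong (k ∷_) (regionArgs-vars ts [] (suc k) s)
    regionArgs-vars (t ∷ ts) ((true , d) ∷ cs) k s =
      trans (cong₂ _++_ (region-vars t d k s) (regionArgs-vars ts cs _ _))
        (trans (sym (interval-++ k (length (holes₁ (region t d k s))) _))
            (cong (interval k) (sym (length-++ (holes₁ (region t d k s))))))
    regionArgs-vars (t ∷ ts) ((false , d) ∷ cs) k s = cong (k ∷_) (regionArgs-vars ts cs _ _)
    region-vars : ∀ t d k s → varsOf ar (⌜_⌝ ar (top (region t d k s))) ≡ interval k (length (holes₁ (region t d k s)))
    region-vars (var x) d k s = refl
    region-vars (fun f ts) hole k s = refl
    region-vars (fun f ts) (node b cs) k s = regionArgs-vars ts cs k s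

  module Carving (α : Gap → T) where
    AssignsAt : ℕ → ℕ × T → Set
    AssignsAt n p = ∀ a → α (n , a) ≡ proj₂ p
    Assigns : ℕ → List (ℕ × T) → Set
    Assigns s ps = AllFrom AssignsAt s ps (0 , var 0)

    SolvesAt : (ℕ → T) → ℕ → Sk → Set
    SolvesAt σ n m = σ n ≡ soT ar α m
    Solves : (ℕ → T) → ℕ → List Sk → Set
    Solves σ k a = AllFrom (SolvesAt σ) k a (svar 0)

    DecoratesAt : (ℕ → Deco) → ℕ → Sk → Set
    DecoratesAt e n m = e n ≡ deco α m
    Decorates : (ℕ → Deco) → ℕ → List Sk → Set
    Decorates e k a = AllFrom (DecoratesAt e) k a (svar 0)

    assigns-++ˡ : ∀ {s} xs ys → Assigns s (xs ++ ys) → Assigns s xs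
    assigns-++ˡ xs ys = allFrom-++ˡ {P = AssignsAt} xs ys
    assigns-++ʳ : ∀ {s} xs ys → Assigns s (xs ++ ys) → Assigns (s + length xs) ys
    assigns-++ʳ xs ys = allFrom-++ʳ {P = AssignsAt} xs ys
    assigns-∷ : ∀ {s} x xs → Assigns s (x ∷ xs) → AssignsAt s x × Assigns (suc s) xs
    assigns-∷ x xs = allFrom-∷ {P = AssignsAt} x xs
    solves-++ˡ : ∀ {σ k} xs ys → Solves σ k (xs ++ ys) → Solves σ k xs
    solves-++ˡ {σ} xs ys = allFrom-++ˡ {P = SolvesAt σ} xs ys
    solves-++ʳ : ∀ {σ k} xs ys → Solves σ k (xs ++ ys) → Solves σ (k + length xs) ys
    solves-++ʳ {σ} xs ys = allFrom-++ʳ {P = SolvesAt σ} xs ys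
    solves-∷ : ∀ {σ k} x xs → Solves σ k (x ∷ xs) → SolvesAt σ k x × Solves σ (suc k) xs
    solves-∷ {σ} x xs = allFrom-∷ {P = SolvesAt σ} x xs
    decorates-++ˡ : ∀ {e k} xs ys → Decorates e k (xs ++ ys) → Decorates e k xs
    decorates-++ˡ {e} xs ys = allFrom-++ˡ {P = DecoratesAt e} xs ys
    decorates-++ʳ : ∀ {e k} xs ys → Decorates e k (xs ++ ys) → Decorates e (k + length xs) ys
    decorates-++ʳ {e} xs ys = allFrom-++ʳ {P = DecoratesAt e} xs ys
    decorates-∷ : ∀ {e k} x xs → Decorates e k (x ∷ xs) → DecoratesAt e k x × Decorates e (suc k) xs
    decorates-∷ {e} x xs = allFrom-∷ {P = DecoratesAt e} x xs

    solves-holes : ∀ (a : List Sk) → Solves (λ k → soT ar α (arg (fromList a) k)) 0 a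
    solves-holes a j lt = cong (soT ar α)
        (trans (lookupℕ-fromList a j (svar j)) (lookupListℕ-default a j (svar j) (svar 0) lt))

    decorates-holes : ∀ (a : List Sk) → Decorates (nthDeco (decoList α (fromList a))) 0 a
    decorates-holes a j lt = trans (nthDeco-decoList α (fromList a) j)
        (cong (deco α) (trans (lookupℕ-fromList a j (svar j)) (lookupListℕ-default a j (svar j) (svar 0) lt)))

    mutual
      carve-soT : ∀ t d s → Fits t d → Closed d → Assigns s (proj₂ (carve t d s)) → soT ar α (proj₁ (carve t d s)) ≡ t
      carve-soT (var k) d s fd v ag = refl
      carve-soT (fun f ts) (node false cs) s fd v ag = cong (fun f) (carveArgs-soT ts cs s fd v ag)
      carve-soT (fun f ts) (node true cs) s fd v ag =
        trans (soT-sgap α (s , length a) (fromList a))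
          (trans (cong (λ x → inst x σ) (proj₁ (assigns-∷ _ _ ag) (length a)))
            (cong (fun f) (regionArgs-soT ts cs 0 (suc s) σ fd v (proj₂ (assigns-∷ _ _ ag)) (solves-holes a))))
        where
          a = holes (regionArgs ts cs 0 (suc s))
          σ = λ k → soT ar α (arg (fromList a) k)
      carveArgs-soT : ∀ {n} (ts : Vec T n) cs s {b} → FitsArgs ts cs → ClosedBelow b cs →
          Assigns s (proj₂ (carveArgs ts cs s)) →
                   soTs ar α (proj₁ (carveArgs ts cs s)) ≡ ts
      carveArgs-soT [] [] s fc v ag = refl
      carveArgs-soT (t ∷ ts) ((e , d) ∷ cs) s (fd , fc) (ve , vd , vc) ag =
        cong₂ _∷_ (carve-soT t d s fd vd (assigns-++ˡ (proj₂ (carve t d s)) _ ag))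
                  (carveArgs-soT ts cs _ fc vc (assigns-++ʳ (proj₂ (carve t d s)) _ ag))
      regionArgs-soT : ∀ {n} (ts : Vec T n) cs k s σ {b} → FitsArgs ts cs → ClosedBelow b cs →
                    Assigns s (gapPats (regionArgs ts cs k s)) → Solves σ k (holes (regionArgs ts cs k s)) →
                    insts (tops (regionArgs ts cs k s)) σ ≡ ts
      regionArgs-soT [] [] k s σ fc v ag hs = refl
      regionArgs-soT (t ∷ ts) ((true , d) ∷ cs) k s σ (fd , fc) (ve , vd , vc) ag hs =
        cong₂ _∷_ (region-soT t d k s σ fd vd (proj₂ (ve refl)) (assigns-++ˡ (gapPats₁ r) _ ag)
            (solves-++ˡ {σ} (holes₁ r) _ hs))
                  (regionArgs-soT ts cs _ _ σ fc vc (assigns-++ʳ (gapPats₁ r) _ ag) (solves-++ʳ {σ} (holes₁ r) _ hs))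
        where r = region t d k s
      regionArgs-soT (t ∷ ts) ((false , d) ∷ cs) k s σ (fd , fc) (ve , vd , vc) ag hs =
        cong₂ _∷_ (trans (proj₁ (solves-∷ {σ} _ _ hs)) (carve-soT t d s fd vd (assigns-++ˡ (proj₂ (carve t d s)) _ ag)))
                  (regionArgs-soT ts cs _ _ σ fc vc (assigns-++ʳ (proj₂ (carve t d s)) _ ag)
                      (proj₂ (solves-∷ {σ} _ _ hs)))
      region-soT : ∀ t d k s σ → Fits t d → Closed d → root d ≡ true →
                   Assigns s (gapPats₁ (region t d k s)) → Solves σ k (holes₁ (region t d k s)) →
                       inst (top (region t d k s)) σ ≡ t
      region-soT (var x) hole k s σ fd v () ag hs
      region-soT (fun f ts) (node b cs) k s σ fc v r ag hs = cong (fun f) (regionArgs-soT ts cs k s σ fc v ag hs)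

    mutual
      carve-deco : ∀ t d s → Fits t d → Closed d → Assigns s (proj₂ (carve t d s)) → deco α (proj₁ (carve t d s)) ≡ d
      carve-deco (var k) hole s fd v ag = refl
      carve-deco (fun f ts) (node false cs) s fd v ag = cong (node false) (carveArgs-deco ts cs s fd v ag)
      carve-deco (fun f ts) (node true cs) s fd v ag =
        trans (cong (λ x → patDeco x (nthDeco (decoList α (fromList a)))) (proj₁ (assigns-∷ _ _ ag) (length a)))
          (cong (node true) (regionArgs-deco ts cs 0 (suc s) _ fd v (proj₂ (assigns-∷ _ _ ag)) (decorates-holes a)))
        where
          a = holes (regionArgs ts cs 0 (suc s))
      carveArgs-deco : ∀ {n} (ts : Vec T n) cs s → FitsArgs ts cs → ClosedBelow false cs →
          Assigns s (proj₂ (carveArgs ts cs s)) →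
                 decoArgs α (proj₁ (carveArgs ts cs s)) ≡ cs
      carveArgs-deco [] [] s fc v ag = refl
      carveArgs-deco (t ∷ ts) ((false , d) ∷ cs) s (fd , fc) (ve , vd , vc) ag =
        cong₂ (λ x y → (false , x) ∷ y) (carve-deco t d s fd vd (assigns-++ˡ (proj₂ (carve t d s)) _ ag))
                  (carveArgs-deco ts cs _ fc vc (assigns-++ʳ (proj₂ (carve t d s)) _ ag))
      carveArgs-deco (t ∷ ts) ((true , d) ∷ cs) s (fd , fc) (ve , vd , vc) ag with proj₁ (ve refl)
      ... | ()
      regionArgs-deco : ∀ {n} (ts : Vec T n) cs k s e {b} → FitsArgs ts cs → ClosedBelow b cs →
                  Assigns s (gapPats (regionArgs ts cs k s)) → Decorates e k (holes (regionArgs ts cs k s)) →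
                  patDecoArgs (tops (regionArgs ts cs k s)) e ≡ cs
      regionArgs-deco [] [] k s e fc v ag he = refl
      regionArgs-deco (t ∷ ts) ((true , d) ∷ cs) k s e (fd , fc) (ve , vd , vc) ag he =
        cong₂ _∷_ (region-deco t d k s e fd vd (proj₂ (ve refl)) (assigns-++ˡ (gapPats₁ r) _ ag)
            (decorates-++ˡ {e} (holes₁ r) _ he))
                  (regionArgs-deco ts cs _ _ e fc vc (assigns-++ʳ (gapPats₁ r) _ ag)
                      (decorates-++ʳ {e} (holes₁ r) _ he))
        where r = region t d k s
      regionArgs-deco (t ∷ ts) ((false , d) ∷ cs) k s e (fd , fc) (ve , vd , vc) ag he =
        cong₂ _∷_ (cong (false ,_)
            (trans (proj₁ (decorates-∷ {e} _ _ he)) (carve-deco t d s fd vd (assigns-++ˡ (proj₂ (carve t d s)) _ ag))))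
                  (regionArgs-deco ts cs _ _ e fc vc (assigns-++ʳ (proj₂ (carve t d s)) _ ag)
                      (proj₂ (decorates-∷ {e} _ _ he)))
      region-deco : ∀ t d k s e → Fits t d → Closed d → root d ≡ true →
                 Assigns s (gapPats₁ (region t d k s)) → Decorates e k (holes₁ (region t d k s)) →
                 (isFun (top (region t d k s)) , patDeco (top (region t d k s)) e) ≡ (true , d)
      region-deco (var x) hole k s e fd v () ag he
      region-deco (fun f ts) (node true cs) k s e fc v r ag he = cong (λ x → true , node true x)
          (regionArgs-deco ts cs k s e fc v ag he)

  assignment : List (ℕ × T) → Gap → T
  assignment ps Z = proj₂ (lookupListℕ ps (proj₁ Z) (0 , var 0))

  assignment-assigns : ∀ ps → Carving.Assigns (assignment ps) 0 ps
  assignment-assigns ps j lt a = refl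

  gapsFrom-≥ : ∀ s ps Z → Z ∈ gapsFrom s ps → s ≤ proj₁ Z
  gapsFrom-≥ s ((a , ℓ) ∷ ps) Z (here refl) = ≤-refl
  gapsFrom-≥ s ((a , ℓ) ∷ ps) Z (there m) = ≤-trans (n≤1+n s) (gapsFrom-≥ (suc s) ps Z m)

  gapsFrom-unique : ∀ s ps → Unique (gapsFrom s ps)
  gapsFrom-unique s [] = []
  gapsFrom-unique s ((a , ℓ) ∷ ps) =
    All.tabulate (λ {Z} Z∈ s,a≡Z → <-irrefl (cong proj₁ s,a≡Z) (gapsFrom-≥ (suc s) ps Z Z∈)) ∷ gapsFrom-unique
        (suc s) ps

  gapsFrom-patterns : ∀ (α : Gap → T) s ps → Carving.Assigns α s ps → All IsPattern ps → ∀ Z → Z ∈ gapsFrom s ps →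
      Pattern ar (proj₂ Z) (α Z)
  gapsFrom-patterns α s ((a , ℓ) ∷ ps) ag (p ∷ ap) Z (here refl) = subst (Pattern ar a)
      (sym (proj₁ (Carving.assigns-∷ α _ _ ag) a)) p
  gapsFrom-patterns α s ((a , ℓ) ∷ ps) ag (p ∷ ap) Z (there m) = gapsFrom-patterns α (suc s) ps
      (proj₂ (Carving.assigns-∷ α _ _ ag)) ap Z m

  canonicalCluster : ∀ t d → Fits t d → Closed d → IC ar t
  canonicalCluster t d fd vd =
    (proj₁ (carve t d 0) , assignment ps) ,
    record { linear = subst Unique (sym (carve-gaps t d 0)) (gapsFrom-unique 0 ps)
           ; patterns = λ Z m → gapsFrom-patterns (assignment ps) 0 ps (assignment-assigns ps) (carve-patterns t d 0) Z
               (subst (Z ∈_) (carve-gaps t d 0) m) } ,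
    Carving.carve-soT (assignment ps) t d 0 fd vd (assignment-assigns ps)
    where ps = proj₂ (carve t d 0)

  canonicalCluster-deco : ∀ t d fd vd → clusterDeco (canonicalCluster t d fd vd) ≡ d
  canonicalCluster-deco t d fd vd = Carving.carve-deco (assignment (proj₂ (carve t d 0))) t d 0 fd vd
      (assignment-assigns (proj₂ (carve t d 0)))

module Instantiation {F : Set} (ar : F → ℕ) where

  open import Defs
  open Decorations
  open Prelude
  open GeometricClusters ar
  open ClusterDecorations ar
  open import Data.Nat using (ℕ)
  open import Data.Vec.Properties using (∷-injectiveˡ; ∷-injectiveʳ)
  open import Data.Vec using (Vec; []; _∷_)
  open import Data.Bool using (Bool; true; false)
  import Data.Bool as Bool
  open import Data.List using (List; []; _∷_; _++_; concatMap)
  open import Data.List.Properties using (++-identityʳ; concatMap-++)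
  open import Data.List.Membership.Propositional using (_∈_)
  open import Data.List.Membership.Propositional.Properties using (∈-++⁺ˡ; ∈-++⁺ʳ; ∈-++⁻)
  open import Data.List.Relation.Unary.Any using (here)
  open import Data.Product using (Σ; _,_)
  open import Data.Sum using (inj₁; inj₂)
  open import Data.Unit using (tt)
  open import Data.Empty using (⊥-elim)
  open import Relation.Binary.PropositionalEquality using (_≡_; refl; sym; trans; cong; cong₂)

  varsT : T → List ℕ
  varsT u = varsOf ar (⌜_⌝ ar u)

  varsTs : ∀ {n} → Vec T n → List ℕ
  varsTs us = varsOfs ar (⌜_⌝s ar us)

  pattern-fun : ∀ {a} p → Pattern ar a p → Σ F λ f → Σ (Vec T (ar f)) λ us → p ≡ fun f us
  pattern-fun (var x)    (nonVar , _) = ⊥-elim (nonVar tt)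
  pattern-fun (fun f us) _            = f , us , refl

  isFun-pattern : ∀ {a} p → Pattern ar a p → isFun p ≡ true
  isFun-pattern p pat with pattern-fun p pat
  ... | _ , _ , refl = refl

  mutual
    inst-ext-vars : ∀ u {σ σ'} → (∀ i → i ∈ varsT u → σ i ≡ σ' i) → inst u σ ≡ inst u σ'
    inst-ext-vars (var k) e = e k (here refl)
    inst-ext-vars (fun f us) e = cong (fun f) (insts-ext-vars us e)
    insts-ext-vars : ∀ {n} (us : Vec T n) {σ σ'} → (∀ i → i ∈ varsTs us → σ i ≡ σ' i) → insts us σ ≡ insts us σ'
    insts-ext-vars [] e = refl
    insts-ext-vars (u ∷ us) e = cong₂ _∷_ (inst-ext-vars u (λ i m → e i (∈-++⁺ˡ m)))
        (insts-ext-vars us (λ i m → e i (∈-++⁺ʳ _ m)))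

  mutual
    instSk-ext-vars : ∀ u {σ σ' : ℕ → Sk} → (∀ i → i ∈ varsOf ar u → σ i ≡ σ' i) → instSk u σ ≡ instSk u σ'
    instSk-ext-vars (svar k) e = e k (here refl)
    instSk-ext-vars (sfun f us) e = cong (sfun f) (instSks-ext-vars us e)
    instSk-ext-vars (sgap Z us) e = cong (sgap Z) (instSks-ext-vars us e)
    instSks-ext-vars : ∀ {n} (us : Vec Sk n) {σ σ' : ℕ → Sk} → (∀ i → i ∈ varsOfs ar us → σ i ≡ σ' i) →
        instSks us σ ≡ instSks us σ'
    instSks-ext-vars [] e = refl
    instSks-ext-vars (u ∷ us) e = cong₂ _∷_ (instSk-ext-vars u (λ i m → e i (∈-++⁺ˡ m)))
        (instSks-ext-vars us (λ i m → e i (∈-++⁺ʳ _ m)))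

  mutual
    inst-inst : ∀ p σ τ → inst (inst p σ) τ ≡ inst p (λ i → inst (σ i) τ)
    inst-inst (var k) σ τ = refl
    inst-inst (fun f us) σ τ = cong (fun f) (insts-insts us σ τ)
    insts-insts : ∀ {n} (us : Vec T n) σ τ → insts (insts us σ) τ ≡ insts us (λ i → inst (σ i) τ)
    insts-insts [] σ τ = refl
    insts-insts (u ∷ us) σ τ = cong₂ _∷_ (inst-inst u σ τ) (insts-insts us σ τ)

  fun-injectiveˡ : ∀ {f g : F} {xs : Vec T (ar f)} {ys : Vec T (ar g)} → fun f xs ≡ fun g ys → f ≡ g
  fun-injectiveˡ refl = refl

  fun-injectiveʳ : ∀ {f : F} {xs ys : Vec T (ar f)} → fun f xs ≡ fun f ys → xs ≡ ys
  fun-injectiveʳ refl = refl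

  mutual
    inst-injective : ∀ p {σ1 σ2} → inst p σ1 ≡ inst p σ2 → ∀ i → i ∈ varsT p → σ1 i ≡ σ2 i
    inst-injective (var k) e i (here refl) = e
    inst-injective (fun f us) e i m = insts-injective us (fun-injectiveʳ e) i m
    insts-injective : ∀ {n} (us : Vec T n) {σ1 σ2} → insts us σ1 ≡ insts us σ2 → ∀ i → i ∈ varsTs us → σ1 i ≡ σ2 i
    insts-injective (u ∷ us) e i m with ∈-++⁻ (varsT u) m
    ... | inj₁ m' = inst-injective u (∷-injectiveˡ e) i m'
    ... | inj₂ m' = insts-injective us (∷-injectiveʳ e) i m'

  mutual
    varsT-inst : ∀ p σ → varsT (inst p σ) ≡ concatMap (λ i → varsT (σ i)) (varsT p)
    varsT-inst (var k) σ = sym (++-identityʳ _)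
    varsT-inst (fun f us) σ = varsTs-insts us σ
    varsTs-insts : ∀ {n} (us : Vec T n) σ → varsTs (insts us σ) ≡ concatMap (λ i → varsT (σ i)) (varsTs us)
    varsTs-insts [] σ = refl
    varsTs-insts (u ∷ us) σ = trans (cong₂ _++_ (varsT-inst u σ) (varsTs-insts us σ))
        (sym (concatMap-++ _ (varsT u) (varsTs us)))

  mutual
    patDeco-inst-≼⁻ : ∀ p σ {e1 e} → patDeco p e1 ≼ patDeco (inst p σ) e → ∀ i → i ∈ varsT p → e1 i ≼ patDeco (σ i) e
    patDeco-inst-≼⁻ (var k) σ h i (here refl) = h
    patDeco-inst-≼⁻ (fun f us) σ (node≼ x c) i m = patDecoArgs-insts-≼⁻ us σ c i m
    patDecoArgs-insts-≼⁻ : ∀ {n} (us : Vec T n) σ {e1 e} → patDecoArgs us e1 ≼* patDecoArgs (insts us σ) e → ∀ i →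
        i ∈ varsTs us → e1 i ≼ patDeco (σ i) e
    patDecoArgs-insts-≼⁻ (u ∷ us) σ (∷≼ x d c) i m with ∈-++⁻ (varsT u) m
    ... | inj₁ m' = patDeco-inst-≼⁻ u σ d i m'
    ... | inj₂ m' = patDecoArgs-insts-≼⁻ us σ c i m'

  mutual
    patDeco-inst-≽⁻ : ∀ p σ {e1 e} → patDeco (inst p σ) e ≼ patDeco p e1 → ∀ i → i ∈ varsT p → patDeco (σ i) e ≼ e1 i
    patDeco-inst-≽⁻ (var k) σ h i (here refl) = h
    patDeco-inst-≽⁻ (fun f us) σ (node≼ x c) i m = patDecoArgs-insts-≽⁻ us σ c i m
    patDecoArgs-insts-≽⁻ : ∀ {n} (us : Vec T n) σ {e1 e} → patDecoArgs (insts us σ) e ≼* patDecoArgs us e1 → ∀ i →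
        i ∈ varsTs us → patDeco (σ i) e ≼ e1 i
    patDecoArgs-insts-≽⁻ (u ∷ us) σ (∷≼ x d c) i m with ∈-++⁻ (varsT u) m
    ... | inj₁ m' = patDeco-inst-≽⁻ u σ d i m'
    ... | inj₂ m' = patDecoArgs-insts-≽⁻ us σ c i m'

  ≤ᵇ-false : ∀ {b} → b Bool.≤ false → b ≡ false
  ≤ᵇ-false Bool.b≤b = refl

  -- Below a function vertex, an unmarked edge into a variable of p cannot become marked,
  -- so a σ that decreases the decoration maps those variables to variables.
  mutual
    insts-holesVar : ∀ {n} (us : Vec T n) σ {e1 e} → patDecoArgs (insts us σ) e ≼* patDecoArgs us e1 → ∀ i →
        i ∈ varsTs us → isFun (σ i) ≡ false
    insts-holesVar (u ∷ us) σ (∷≼ x d c) i m with ∈-++⁻ (varsT u) m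
    ... | inj₂ m' = insts-holesVar us σ c i m'
    insts-holesVar (var k ∷ us) σ (∷≼ x d c) i m | inj₁ (here refl) = ≤ᵇ-false x
    insts-holesVar (fun f vs ∷ us) σ (∷≼ x (node≼ y c') c) i m | inj₁ m' = insts-holesVar vs σ c' i m'

  inst-holesVar : ∀ p σ {e1 e} → isFun p ≡ true → patDeco (inst p σ) e ≼ patDeco p e1 →
                  ∀ i → i ∈ varsT p → isFun (σ i) ≡ false
  inst-holesVar (fun f us) σ refl (node≼ _ ≼*) = insts-holesVar us σ ≼*

module Cutting {F : Set} (ar : F → ℕ) where

  open import Defs
  open Decorations
  open Prelude
  open GeometricClusters ar
  open ClusterDecorations ar
  open Instantiation ar
  open import Data.Nat using (ℕ; zero; suc; _<_)
  open import Data.Nat.Properties using (_≟_)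
  open import Data.Bool using (true; false; if_then_else_)
  import Data.Bool as Bool
  open import Data.Bool.Properties using (≤-maximum)
  open import Data.Vec using (Vec; []; _∷_)
  open import Data.Vec.Properties using (∷-injectiveˡ; ∷-injectiveʳ)
  open import Data.List using (List; []; _∷_; _++_; [_]; length; concatMap)
  import Data.List.Properties as List
  open import Data.List.Membership.Propositional using (_∈_; _∉_)
  open import Data.List.Membership.Propositional.Properties using (∈-++⁻)
  open import Data.List.Membership.DecPropositional _≟_ using (_∈?_)
  open import Data.List.Relation.Unary.Any using (here; there)
  open import Data.List.Relation.Unary.All using (All; _∷_)
  open import Data.List.Relation.Unary.All.Properties using (++⁻ˡ; ++⁻ʳ)
  open import Data.List.Relation.Unary.Unique.Propositional using (Unique)
  open import Data.Product using (Σ; _×_; _,_; proj₁; proj₂)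
  open import Data.Sum using (inj₁; inj₂)
  open import Data.Unit using (tt)
  open import Function.Base using (_∘_)
  open import Relation.Nullary using (¬_; does)
  open import Relation.Nullary.Decidable using (dec-true; dec-false)
  open import Relation.Binary.PropositionalEquality using
      (_≡_; refl; sym; trans; cong; cong₂; subst; subst₂; module ≡-Reasoning)

  choose : {A : Set} → List ℕ → (ℕ → A) → (ℕ → A) → ℕ → A
  choose xs f g i = if does (i ∈? xs) then f i else g i

  choose-∈ : ∀ {A : Set} {xs} (f g : ℕ → A) {i} → i ∈ xs → choose xs f g i ≡ f i
  choose-∈ f g {i} i∈ rewrite dec-true (i ∈? _) i∈ = refl

  choose-∉ : ∀ {A : Set} {xs} (f g : ℕ → A) {i} → i ∉ xs → choose xs f g i ≡ g i
  choose-∉ f g {i} i∉ rewrite dec-false (i ∈? _) i∉ = refl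

  choose-++ : ∀ {A : Set} (P : ℕ → A → Set) xs {ys} {f g : ℕ → A} → Unique (xs ++ ys) →
              (∀ i → i ∈ xs → P i (f i)) → (∀ i → i ∈ ys → P i (g i)) →
              ∀ i → i ∈ xs ++ ys → P i (choose xs f g i)
  choose-++ P xs {f = f} {g} u Pf Pg i i∈ with ∈-++⁻ xs i∈
  ... | inj₁ i∈xs = subst (P i) (sym (choose-∈ f g i∈xs)) (Pf i i∈xs)
  ... | inj₂ i∈ys = subst (P i) (sym (choose-∉ f g (unique-++-disjoint xs u i∈ys))) (Pg i i∈ys)

  instSk-choose-∈ : ∀ c {xs} {f g : ℕ → Sk} → varsOf ar c ≡ xs → instSk c (choose xs f g) ≡ instSk c f
  instSk-choose-∈ c {f = f} {g} refl = instSk-ext-vars c (λ i → choose-∈ f g)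

  instSks-choose-∉ : ∀ {n} (cs : Vec Sk n) {xs ys} {f g : ℕ → Sk} → Unique (xs ++ ys) → varsOfs ar cs ≡ ys →
                     instSks cs (choose xs f g) ≡ instSks cs g
  instSks-choose-∉ cs {xs} {f = f} {g} u refl = instSks-ext-vars cs (λ i i∈ → choose-∉ f g (unique-++-disjoint xs u i∈))

  -- match p ℓ computes the substitution σ with inst p σ ≡ ℓ, when there is one.
  mutual
    match : T → T → ℕ → T
    match (var j)    ℓ          i = choose [ j ] (λ _ → ℓ) var i
    match (fun g ps) (var x)    i = var i
    match (fun g ps) (fun f ls) i = matchArgs ps ls i
    matchArgs : ∀ {n m} → Vec T n → Vec T m → ℕ → T
    matchArgs []       ls       i = var i
    matchArgs (p ∷ ps) []       i = var i
    matchArgs (p ∷ ps) (l ∷ ls) i = choose (varsT p) (match p l) (matchArgs ps ls) i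

  data Cover : T → T → Set
  data Covers : ∀ {n} → Vec T n → Vec T n → Set
  data Cover where
    cvar : ∀ {j ℓ} → Cover (var j) ℓ
    cfun : ∀ {f ps ls} → Covers ps ls → Cover (fun f ps) (fun f ls)
  data Covers where
    []  : Covers [] []
    _∷_ : ∀ {n p l} {ps ls : Vec T n} → Cover p l → Covers ps ls → Covers (p ∷ ps) (l ∷ ls)

  mutual
    inst-match : ∀ {p ℓ} → Cover p ℓ → Unique (varsT p) → inst p (match p ℓ) ≡ ℓ
    inst-match {var j} {ℓ} cvar _ = choose-∈ {xs = [ j ]} (λ _ → ℓ) var (here refl)
    inst-match (cfun cs) u = cong (fun _) (insts-matchArgs cs u)
    insts-matchArgs : ∀ {n} {ps ls : Vec T n} → Covers ps ls → Unique (varsTs ps) → insts ps (matchArgs ps ls) ≡ ls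
    insts-matchArgs []                   u = refl
    insts-matchArgs {ps = p ∷ ps} {l ∷ ls} (c ∷ cs) u = cong₂ _∷_
      (trans (inst-ext-vars p (λ i → choose-∈ (match p l) (matchArgs ps ls))) (inst-match c (unique-++ˡ (varsT p) _ u)))
      (trans (insts-ext-vars ps (λ i i∈ → choose-∉ (match p l) (matchArgs ps ls) (unique-++-disjoint (varsT p) u i∈)))
             (insts-matchArgs cs (unique-++ʳ (varsT p) _ u)))

  mutual
    cover : ∀ p ℓ {σ τ e₁ e₂} → isFun p Bool.≤ isFun ℓ → inst p σ ≡ inst ℓ τ → patDeco p e₁ ≼ patDeco ℓ e₂ → Cover p ℓ
    cover (var j)    ℓ          _  _    _              = cvar
    cover (fun g ps) (var k)    () _    _
    cover (fun g ps) (fun f ls) _  inst≡ (node≼ _ ds≼) with fun-injectiveˡ inst≡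
    ... | refl = cfun (covers ps ls (fun-injectiveʳ inst≡) ds≼)
    covers : ∀ {n} (ps ls : Vec T n) {σ τ e₁ e₂} → insts ps σ ≡ insts ls τ →
             patDecoArgs ps e₁ ≼* patDecoArgs ls e₂ → Covers ps ls
    covers []       []       _     _              = []
    covers (p ∷ ps) (l ∷ ls) insts≡ (∷≼ isFun≤ d≼ ds≼) =
      cover p l isFun≤ (∷-injectiveˡ insts≡) d≼ ∷ covers ps ls (∷-injectiveʳ insts≡) ds≼

  svars : (n : ℕ) → ℕ → Vec Sk n
  svars zero    k = []
  svars (suc n) k = svar k ∷ svars n (suc k)

  isFun-false : ∀ u → isFun u ≡ false → Σ ℕ λ x → u ≡ var x
  isFun-false (var x) _ = x , refl

  holeVars : (ℕ → T) → ℕ → ℕ → List ℕ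
  holeVars σ j0 n = concatMap (varsT ∘ σ) (interval j0 n)

  holeVars-length : ∀ σ j0 n → (∀ j → j ∈ interval j0 n → isFun (σ j) ≡ false) → length (holeVars σ j0 n) ≡ n
  holeVars-length σ j0 zero    _          = refl
  holeVars-length σ j0 (suc n) holes-vars with isFun-false (σ j0) (holes-vars j0 (here refl))
  ... | x , σj0≡x rewrite σj0≡x = cong suc (holeVars-length σ (suc j0) n (λ j j∈ → holes-vars j (there j∈)))

  -- A fine skeleton m with soT α m ≡ inst ℓ τ is cut along the coarse pattern ℓ: the part of m
  -- lying inside ℓ becomes a pattern-skeleton `cut m ℓ`, and `piece m ℓ i` is the part of m
  -- below the variable i of ℓ, so that m is recovered by plugging the pieces into the cut.
  module Cut (α : Gap → T) where

    PatternAt : Gap → Set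
    PatternAt Y = Pattern ar (proj₂ Y) (α Y)

    Patterned : Sk → Set
    Patterned m = All PatternAt (gapsOf ar m)

    mutual
      cut : Sk → T → Sk
      cut m           (var k)    = svar k
      cut (svar x)    (fun f us) = svar 0
      cut (sfun g ms) (fun f us) = sfun g (cutArgs ms us)
      cut (sgap Y ys) (fun f us) = sgap Y (cutHoles ys (match (α Y) (fun f us)) 0)
      cutArgs : ∀ {n m} → Vec Sk n → Vec T m → Vec Sk n
      cutArgs []       us       = []
      cutArgs (m ∷ ms) []       = m ∷ cutArgs ms []
      cutArgs (m ∷ ms) (u ∷ us) = cut m u ∷ cutArgs ms us
      cutHoles : ∀ {n} → Vec Sk n → (ℕ → T) → ℕ → Vec Sk n
      cutHoles []       σ j = []
      cutHoles (y ∷ ys) σ j = cut y (σ j) ∷ cutHoles ys σ (suc j)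

    mutual
      piece : Sk → T → ℕ → Sk
      piece m           (var k)    i = choose [ k ] (λ _ → m) svar i
      piece (svar x)    (fun f us) i = svar i
      piece (sfun g ms) (fun f us) i = pieceArgs ms us i
      piece (sgap Y ys) (fun f us) i = pieceHoles ys (match (α Y) (fun f us)) 0 i
      pieceArgs : ∀ {n m} → Vec Sk n → Vec T m → ℕ → Sk
      pieceArgs []       us       i = svar i
      pieceArgs (m ∷ ms) []       i = svar i
      pieceArgs (m ∷ ms) (u ∷ us) i = choose (varsT u) (piece m u) (pieceArgs ms us) i
      pieceHoles : ∀ {n} → Vec Sk n → (ℕ → T) → ℕ → ℕ → Sk
      pieceHoles []       σ j i = svar i
      pieceHoles (y ∷ ys) σ j i = choose (varsT (σ j)) (piece y (σ j)) (pieceHoles ys σ (suc j)) i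

    piece-var : ∀ m k → piece m (var k) k ≡ m
    piece-var m k = choose-∈ {xs = [ k ]} (λ _ → m) svar (here refl)

    PieceOK : (ℕ → T) → (ℕ → Deco) → ℕ → Sk → Set
    PieceOK τ e i m = soT ar α m ≡ τ i × deco α m ≼ e i × Patterned m

    CutHyp : Sk → T → (ℕ → T) → (ℕ → Deco) → Set
    CutHyp m ℓ τ e = soT ar α m ≡ inst ℓ τ × deco α m ≼ patDeco ℓ e × Patterned m × Unique (varsT ℓ)

    CutArgsHyp : ∀ {n} → Vec Sk n → Vec T n → (ℕ → T) → (ℕ → Deco) → Set
    CutArgsHyp ms us τ e =
      soTs ar α ms ≡ insts us τ × decoArgs α ms ≼* patDecoArgs us e × All PatternAt (gapsOfs ar ms) × Unique (varsTs us)

    HoleHyp : (ℕ → T) → (ℕ → T) → (ℕ → Deco) → ℕ → Sk → Set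
    HoleHyp σ τ e j y = soT ar α y ≡ inst (σ j) τ × deco α y ≼ patDeco (σ j) e

    CutHolesHyp : ∀ {n} → Vec Sk n → (ℕ → T) → ℕ → (ℕ → T) → (ℕ → Deco) → Set
    CutHolesHyp {n} ys σ j0 τ e = AllAt (HoleHyp σ τ e) ys j0 × All PatternAt (gapsOfs ar ys) × Unique (holeVars σ j0 n)

    record CutSpec (m : Sk) (ℓ : T) (τ : ℕ → T) (e : ℕ → Deco) : Set where
      field
        soT-cut   : soT ar α (cut m ℓ) ≡ ℓ
        vars-cut  : varsOf ar (cut m ℓ) ≡ varsT ℓ
        glue      : instSk (cut m ℓ) (piece m ℓ) ≡ m
        pieces-ok : ∀ i → i ∈ varsT ℓ → PieceOK τ e i (piece m ℓ i)

    record CutArgsSpec {n} (ms : Vec Sk n) (us : Vec T n) (τ : ℕ → T) (e : ℕ → Deco) : Set where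
      field
        soT-cut   : soTs ar α (cutArgs ms us) ≡ us
        vars-cut  : varsOfs ar (cutArgs ms us) ≡ varsTs us
        glue      : instSks (cutArgs ms us) (pieceArgs ms us) ≡ ms
        pieces-ok : ∀ i → i ∈ varsTs us → PieceOK τ e i (pieceArgs ms us i)

    record CutHolesSpec {n} (ys : Vec Sk n) (σ : ℕ → T) (j0 : ℕ) (τ : ℕ → T) (e : ℕ → Deco) : Set where
      field
        soT-cut   : AllAt (λ j c → soT ar α c ≡ σ j) (cutHoles ys σ j0) j0
        vars-cut  : varsOfs ar (cutHoles ys σ j0) ≡ holeVars σ j0 n
        glue      : instSks (cutHoles ys σ j0) (pieceHoles ys σ j0) ≡ ys
        pieces-ok : ∀ i → i ∈ holeVars σ j0 n → PieceOK τ e i (pieceHoles ys σ j0 i)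

    -- When the coarse pattern ℓ lies over a gap Y of the fine skeleton, it is an instance of α Y.
    module GapMatch {Y : Gap} (ys : Vec Sk (proj₂ Y)) {f : F} {us : Vec T (ar f)} {τ : ℕ → T} {e : ℕ → Deco}
                    (pY : PatternAt Y) (soT≡ : soT ar α (sgap Y ys) ≡ inst (fun f us) τ)
                    (deco≼ : deco α (sgap Y ys) ≼ patDeco (fun f us) e) where

      ℓ : T
      ℓ = fun f us

      σ : ℕ → T
      σ = match (α Y) ℓ

      σ₁ : ℕ → T
      σ₁ j = soT ar α (arg ys j)

      e₁ : ℕ → Deco
      e₁ j = deco α (arg ys j)

      vars-pattern : varsT (α Y) ≡ interval 0 (proj₂ Y)
      vars-pattern = trans (proj₂ pY) (upTo-interval (proj₂ Y))

      ∈pattern : ∀ {j} → j < proj₂ Y → j ∈ varsT (α Y)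
      ∈pattern j< = subst (_ ∈_) (sym vars-pattern) (<⇒∈interval j<)

      inst-σ₁ : inst (α Y) σ₁ ≡ inst ℓ τ
      inst-σ₁ = trans (sym (soT-sgap α Y ys)) soT≡

      patDeco-e₁ : patDeco (α Y) e₁ ≼ patDeco ℓ e
      patDeco-e₁ = subst (_≼ patDeco ℓ e) (deco-sgap α Y ys) deco≼

      inst-σ : inst (α Y) σ ≡ ℓ
      inst-σ = inst-match (cover (α Y) ℓ (≤-maximum _) inst-σ₁ patDeco-e₁)
                          (subst Unique (sym vars-pattern) (interval-unique 0 (proj₂ Y)))

      vars-ℓ : varsT ℓ ≡ holeVars σ 0 (proj₂ Y)
      vars-ℓ = begin
        varsT ℓ                                       ≡⟨ cong varsT (sym inst-σ) ⟩
        varsT (inst (α Y) σ)                          ≡⟨ varsT-inst (α Y) σ ⟩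
        concatMap (varsT ∘ σ) (varsT (α Y))           ≡⟨ cong (concatMap (varsT ∘ σ)) vars-pattern ⟩
        holeVars σ 0 (proj₂ Y)                        ∎
        where open ≡-Reasoning

      holes-hyp : AllAt (HoleHyp σ τ e) ys 0
      holes-hyp = allAt _ ys 0 (svar 0) λ j j< →
        subst (HoleHyp σ τ e j) (lookupℕ-default ys j (svar j) (svar 0) j<)
          ( inst-injective (α Y) (trans inst-σ₁ (trans (cong (λ p → inst p τ) (sym inst-σ)) (inst-inst (α Y) σ τ)))
                           j (∈pattern j<)
          , patDeco-inst-≼⁻ (α Y) σ (subst (λ p → patDeco (α Y) e₁ ≼ patDeco p e) (sym inst-σ) patDeco-e₁) j
              (∈pattern j<))

    mutual
      cut-spec : ∀ m ℓ τ e → CutHyp m ℓ τ e → CutSpec m ℓ τ e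
      cut-spec m (var k) τ e (soT≡ , deco≼ , pat , _) = record
        { soT-cut   = refl
        ; vars-cut  = refl
        ; glue      = piece-var m k
        ; pieces-ok = λ { i (here refl) → subst (PieceOK τ e i) (sym (piece-var m k)) (soT≡ , deco≼ , pat) }
        }
      cut-spec (svar x) (fun f us) τ e (() , _)
      cut-spec (sfun g ms) (fun f us) τ e (soT≡ , node≼ _ ds≼ , pat , u) with fun-injectiveˡ soT≡
      ... | refl = record
        { soT-cut = cong (fun f) A.soT-cut ; vars-cut = A.vars-cut ; glue = cong
            (sfun f) A.glue ; pieces-ok = A.pieces-ok }
        where module A = CutArgsSpec (cutArgs-spec ms us τ e (fun-injectiveʳ soT≡ , ds≼ , pat , u))
      cut-spec (sgap Y ys) (fun f us) τ e (soT≡ , deco≼ , pY ∷ pat , u) = record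
        { soT-cut   = trans (soT-sgap α Y (cutHoles ys σ 0)) (trans (inst-ext-vars (α Y) hole-soT) inst-σ)
        ; vars-cut  = trans H.vars-cut (sym vars-ℓ)
        ; glue      = cong (sgap Y) H.glue
        ; pieces-ok = λ i i∈ → H.pieces-ok i (subst (i ∈_) vars-ℓ i∈)
        }
        where
          open GapMatch ys pY soT≡ deco≼
          module H = CutHolesSpec (cutHoles-spec ys σ 0 τ e (holes-hyp , pat , subst Unique vars-ℓ u))
          hole-soT : ∀ j → j ∈ varsT (α Y) → soT ar α (arg (cutHoles ys σ 0) j) ≡ σ j
          hole-soT j j∈ = allAt-lookup (cutHoles ys σ 0) 0 H.soT-cut j (svar j)
              (∈interval⇒< (subst (j ∈_) vars-pattern j∈))

      cutArgs-spec : ∀ {n} (ms : Vec Sk n) (us : Vec T n) τ e → CutArgsHyp ms us τ e → CutArgsSpec ms us τ e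
      cutArgs-spec [] [] τ e _ = record { soT-cut = refl ; vars-cut = refl ; glue = refl ; pieces-ok = λ _ () }
      cutArgs-spec (m ∷ ms) (u ∷ us) τ e (soT≡ , ∷≼ _ d≼ ds≼ , pat , uniq) = record
        { soT-cut   = cong₂ _∷_ C.soT-cut A.soT-cut
        ; vars-cut  = cong₂ _++_ C.vars-cut A.vars-cut
        ; glue      = cong₂ _∷_ (trans (instSk-choose-∈ (cut m u) C.vars-cut) C.glue)
                                (trans (instSks-choose-∉ (cutArgs ms us) uniq A.vars-cut) A.glue)
        ; pieces-ok = choose-++ (PieceOK τ e) (varsT u) uniq C.pieces-ok A.pieces-ok
        }
        where
          module C = CutSpec (cut-spec m u τ e
            (∷-injectiveˡ soT≡ , d≼ , ++⁻ˡ (gapsOf ar m) pat , unique-++ˡ (varsT u) _ uniq))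
          module A = CutArgsSpec (cutArgs-spec ms us τ e
            (∷-injectiveʳ soT≡ , ds≼ , ++⁻ʳ (gapsOf ar m) pat , unique-++ʳ (varsT u) _ uniq))

      cutHoles-spec : ∀ {n} (ys : Vec Sk n) σ j0 τ e → CutHolesHyp ys σ j0 τ e → CutHolesSpec ys σ j0 τ e
      cutHoles-spec [] σ j0 τ e _ = record { soT-cut = tt ; vars-cut = refl ; glue = refl ; pieces-ok = λ _ () }
      cutHoles-spec (y ∷ ys) σ j0 τ e ((y-hyp , ys-hyp) , pat , uniq) = record
        { soT-cut   = C.soT-cut , H.soT-cut
        ; vars-cut  = cong₂ _++_ C.vars-cut H.vars-cut
        ; glue      = cong₂ _∷_ (trans (instSk-choose-∈ (cut y (σ j0)) C.vars-cut) C.glue)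
                                (trans (instSks-choose-∉ (cutHoles ys σ (suc j0)) uniq H.vars-cut) H.glue)
        ; pieces-ok = choose-++ (PieceOK τ e) (varsT (σ j0)) uniq C.pieces-ok H.pieces-ok
        }
        where
          module C = CutSpec (cut-spec y (σ j0) τ e
            (proj₁ y-hyp , proj₂ y-hyp , ++⁻ˡ (gapsOf ar y) pat , unique-++ˡ (varsT (σ j0)) _ uniq))
          module H = CutHolesSpec (cutHoles-spec ys σ (suc j0) τ e
            (ys-hyp , ++⁻ʳ (gapsOf ar y) pat , unique-++ʳ (varsT (σ j0)) _ uniq))

    cut-nonVar : ∀ m ℓ {τ} → isFun ℓ ≡ true → soT ar α m ≡ inst ℓ τ → ¬ IsVar ar (cut m ℓ)
    cut-nonVar (svar x)    (fun f us) refl ()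
    cut-nonVar (sfun g ms) (fun f us) refl _ ()
    cut-nonVar (sgap Y ys) (fun f us) refl _ ()

  -- If moreover the decorations agree, the cut is a single gap over distinct variables:
  -- the two clusters differ there only by the name of the gap.
  module CutRenaming (α : Gap → T) where
    open Cut α

    cutHoles-svars : ∀ {n} (ys : Vec Sk n) σ j0 k → (∀ j → j ∈ interval j0 n → isFun (σ j) ≡ false) →
                     holeVars σ j0 n ≡ interval k n → cutHoles ys σ j0 ≡ svars n k
    cutHoles-svars []       σ j0 k _          _     = refl
    cutHoles-svars (y ∷ ys) σ j0 k holes-vars vars≡ with isFun-false (σ j0) (holes-vars j0 (here refl))
    ... | x , σj0≡x rewrite σj0≡x =
      cong₂ _∷_ (cong svar (List.∷-injectiveˡ vars≡))
                (cutHoles-svars ys σ (suc j0) (suc k) (λ j j∈ → holes-vars j (there j∈)) (List.∷-injectiveʳ vars≡))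

    pieceHoles-≽ : ∀ {n} (ys : Vec Sk n) σ j0 (e : ℕ → Deco) → (∀ j → j ∈ interval j0 n → isFun (σ j) ≡ false) →
                   Unique (holeVars σ j0 n) → AllAt (λ j y → patDeco (σ j) e ≼ deco α y) ys j0 →
                   ∀ i → i ∈ holeVars σ j0 n → e i ≼ deco α (pieceHoles ys σ j0 i)
    pieceHoles-≽ (y ∷ ys) σ j0 e holes-vars u (y≽ , ys≽) i i∈ with isFun-false (σ j0) (holes-vars j0 (here refl))
    ... | x , σj0≡x rewrite σj0≡x with i∈
    ... | here refl rewrite dec-true (x ∈? x ∷ []) (here refl) = y≽
    ... | there i∈′ rewrite dec-false (i ∈? x ∷ []) (unique-++-disjoint (x ∷ []) u i∈′) =
      pieceHoles-≽ ys σ (suc j0) e (λ j j∈ → holes-vars j (there j∈)) (unique-++ʳ (x ∷ []) _ u) ys≽ i i∈′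

    cut-renaming : ∀ m ℓ τ e a → isFun ℓ ≡ true → CutHyp m ℓ τ e → patDeco ℓ e ≼ deco α m → varsT ℓ ≡ interval 0 a →
                   (Σ ℕ λ y → cut m ℓ ≡ sgap (y , a) (svars a 0)) × (∀ i → i ∈ varsT ℓ → e i ≼ deco α (piece m ℓ i))
    cut-renaming (svar x)          (fun f us) τ e a refl (() , _)
    cut-renaming (sfun g ms)       (fun f us) τ e a refl _ (node≼ () _)
    cut-renaming (sgap (y , n) ys) (fun f us) τ e a refl (soT≡ , deco≼ , pY ∷ _ , u) ≽ vars≡ = (y , cut≡) , pieces≽
      where
        open GapMatch ys pY soT≡ deco≼
        patDeco-≽ : patDeco (inst (α (y , n)) σ) e ≼ patDeco (α (y , n)) e₁
        patDeco-≽ = subst₂ _≼_ (cong (λ p → patDeco p e) (sym inst-σ)) (deco-sgap α (y , n) ys) ≽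
        holes-vars : ∀ j → j ∈ interval 0 n → isFun (σ j) ≡ false
        holes-vars j j∈ = inst-holesVar (α (y , n)) σ (isFun-pattern (α (y , n)) pY) patDeco-≽ j
                                        (subst (j ∈_) (sym vars-pattern) j∈)
        arity≡ : n ≡ a
        arity≡ = trans (sym (holeVars-length σ 0 n holes-vars))
                       (trans (cong length (trans (sym vars-ℓ) vars≡)) (interval-length 0 a))
        cut≡ : sgap (y , n) (cutHoles ys σ 0) ≡ sgap (y , a) (svars a 0)
        cut≡ with arity≡
        ... | refl = cong (sgap (y , n)) (cutHoles-svars ys σ 0 0 holes-vars (trans (sym vars-ℓ) vars≡))
        holes-≽ : AllAt (λ j y → patDeco (σ j) e ≼ deco α y) ys 0
        holes-≽ = allAt _ ys 0 (svar 0) λ j j< →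
          subst (λ z → patDeco (σ j) e ≼ deco α z) (lookupℕ-default ys j (svar j) (svar 0) j<)
                (patDeco-inst-≽⁻ (α (y , n)) σ patDeco-≽ j (∈pattern j<))
        pieces≽ : ∀ i → i ∈ varsT (fun f us) → e i ≼ deco α (pieceHoles ys σ 0 i)
        pieces≽ i i∈ = pieceHoles-≽ ys σ 0 e holes-vars (subst Unique vars-ℓ u) holes-≽ i (subst (i ∈_) vars-ℓ i∈)

module Walking {F : Set} (ar : F → ℕ) where

  open import Defs
  open Decorations
  open Prelude
  open GeometricClusters ar
  open ClusterDecorations ar
  open Instantiation ar
  open Cutting ar
  open import Data.Nat using (ℕ; suc; _<_)
  open import Data.Nat.Properties using (_≟_)
  open import Data.Bool using (false)
  import Data.Bool as Bool
  open import Data.Product as Product using (Σ; _×_; _,_; proj₁; proj₂)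
  open import Function.Base using (_∘_)
  open import Data.Product.Properties using (≡-dec)
  open import Data.Vec using (Vec; []; _∷_; toList)
  open import Data.Vec.Properties using (∷-injectiveˡ; ∷-injectiveʳ)
  open import Data.List using (List; []; _∷_; _++_; map)
  open import Data.List.Properties using (map-++)
  open import Data.List.Membership.Propositional using (_∈_)
  open import Data.List.Membership.Propositional.Properties using (∈-map⁺)
  open import Data.List.Relation.Unary.Any using (here; there)
  open import Data.List.Relation.Unary.All as All using (All; []; _∷_)
  open import Data.List.Relation.Unary.All.Properties using (++⁺; ++⁻ˡ; ++⁻ʳ)
  open import Data.List.Relation.Unary.Unique.Propositional using (Unique)
  open import Data.List.Relation.Unary.AllPairs using (_∷_)
  open import Data.Unit using (tt)
  open import Data.Empty using (⊥-elim)
  open import Relation.Nullary using (¬_; yes; no)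
  open import Relation.Binary.Definitions using (DecidableEquality)
  open import Relation.Binary.PropositionalEquality using
      (_≡_; refl; sym; trans; cong; cong₂; subst; module ≡-Reasoning)

  _≟ᴳ_ : DecidableEquality Gap
  _≟ᴳ_ = ≡-dec _≟_ _≟_

  lookupAssoc : List (Gap × Sk) → Gap → Sk
  lookupAssoc []              Z = svar 0
  lookupAssoc ((Z' , g) ∷ xs) Z with Z ≟ᴳ Z'
  ... | yes _ = g
  ... | no  _ = lookupAssoc xs Z

  Agrees : (Gap → Sk) → List (Gap × Sk) → Set
  Agrees γ = All (λ (Z , g) → γ Z ≡ g)

  lookupAssoc-∈ : ∀ {xs Z g} → Unique (map proj₁ xs) → (Z , g) ∈ xs → lookupAssoc xs Z ≡ g
  lookupAssoc-∈ {(Z , g) ∷ xs} _ (here refl) with Z ≟ᴳ Z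
  ... | yes _   = refl
  ... | no Z≢Z = ⊥-elim (Z≢Z refl)
  lookupAssoc-∈ {(Z' , g') ∷ xs} {Z} (Z'∉ ∷ u) (there Zg∈) with Z ≟ᴳ Z'
  ... | yes refl = ⊥-elim (All.lookup Z'∉ (∈-map⁺ proj₁ Zg∈) refl)
  ... | no  _    = lookupAssoc-∈ u Zg∈

  lookupAssoc-agrees : ∀ xs → Unique (map proj₁ xs) → Agrees (lookupAssoc xs) xs
  lookupAssoc-agrees xs u = All.tabulate (lookupAssoc-∈ u)

  argList : Sk → List Sk
  argList (sfun g ms) = toList ms
  argList _           = []

  -- Walking along the coarse skeleton N, the fine skeleton m (with the same term and a smaller
  -- decoration) is cut at every gap Z of N along the pattern β Z; the cut is the image of Z.
  module Walk (α β : Gap → T) where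
    open Cut α

    PatternAtβ : Gap → Set
    PatternAtβ Z = Pattern ar (proj₂ Z) (β Z)

    mutual
      gapImages : Sk → Sk → List (Gap × Sk)
      gapImages (svar x)    m = []
      gapImages (sfun f ns) m = gapImagesArgs ns (argList m)
      gapImages (sgap Z ns) m = (Z , cut m (β Z)) ∷ gapImagesHoles ns (piece m (β Z)) 0
      gapImagesArgs : ∀ {n} → Vec Sk n → List Sk → List (Gap × Sk)
      gapImagesArgs []       xs       = []
      gapImagesArgs (N ∷ ns) []       = gapImages N (svar 0) ++ gapImagesArgs ns []
      gapImagesArgs (N ∷ ns) (m ∷ ms) = gapImages N m ++ gapImagesArgs ns ms
      gapImagesHoles : ∀ {n} → Vec Sk n → (ℕ → Sk) → ℕ → List (Gap × Sk)
      gapImagesHoles []       h j = []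
      gapImagesHoles (N ∷ ns) h j = gapImages N (h j) ++ gapImagesHoles ns h (suc j)

    mutual
      gapImages-gaps : ∀ N m → map proj₁ (gapImages N m) ≡ gapsOf ar N
      gapImages-gaps (svar x)    m = refl
      gapImages-gaps (sfun f ns) m = gapImagesArgs-gaps ns (argList m)
      gapImages-gaps (sgap Z ns) m = cong (Z ∷_) (gapImagesHoles-gaps ns _ 0)
      gapImagesArgs-gaps : ∀ {n} (ns : Vec Sk n) ms → map proj₁ (gapImagesArgs ns ms) ≡ gapsOfs ar ns
      gapImagesArgs-gaps []       ms       = refl
      gapImagesArgs-gaps (N ∷ ns) []       =
        trans (map-++ proj₁ (gapImages N (svar 0)) _) (cong₂ _++_ (gapImages-gaps N _) (gapImagesArgs-gaps ns []))
      gapImagesArgs-gaps (N ∷ ns) (m ∷ ms) =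
        trans (map-++ proj₁ (gapImages N m) _) (cong₂ _++_ (gapImages-gaps N _) (gapImagesArgs-gaps ns ms))
      gapImagesHoles-gaps : ∀ {n} (ns : Vec Sk n) h j → map proj₁ (gapImagesHoles ns h j) ≡ gapsOfs ar ns
      gapImagesHoles-gaps []       h j = refl
      gapImagesHoles-gaps (N ∷ ns) h j =
        trans (map-++ proj₁ (gapImages N (h j)) _) (cong₂ _++_ (gapImages-gaps N _) (gapImagesHoles-gaps ns h (suc j)))

    ValidImage : Gap × Sk → Set
    ValidImage (Z , g) = PatternSkel ar (proj₂ Z) g × β Z ≡ soT ar α g

    RenamingImage : Gap × Sk → Set
    RenamingImage (Z , g) = Σ ℕ λ y → g ≡ sgap (y , proj₂ Z) (svars (proj₂ Z) 0)

    WalkHyp : Sk → Sk → Set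
    WalkHyp N m = soT ar α m ≡ soT ar β N × deco α m ≼ deco β N × Patterned m × All PatternAtβ (gapsOf ar N)

    WalkArgsHyp : ∀ {n} → Vec Sk n → Vec Sk n → Set
    WalkArgsHyp ns ms =
      soTs ar α ms ≡ soTs ar β ns × decoArgs α ms ≼* decoArgs β ns × All PatternAt (gapsOfs ar ms) ×
          All PatternAtβ (gapsOfs ar ns)

    HoleWalkHyp : (ℕ → Sk) → ℕ → Sk → Set
    HoleWalkHyp h j N = soT ar α (h j) ≡ soT ar β N × deco α (h j) ≼ deco β N × Patterned (h j)

    WalkHolesHyp : ∀ {n} → Vec Sk n → (ℕ → Sk) → ℕ → Set
    WalkHolesHyp ns h j0 = AllAt (HoleWalkHyp h) ns j0 × All PatternAtβ (gapsOfs ar ns)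

    var-of-soT : ∀ m {x} → Patterned m → soT ar α m ≡ var x → m ≡ svar x
    var-of-soT (svar y)    _         refl = refl
    var-of-soT (sgap Y ys) (pY ∷ _) soT≡ with pattern-fun (α Y) pY
    ... | f , us , αY≡ with trans (sym soT≡)
        (trans (soT-sgap α Y ys) (cong (λ p → inst p (λ k → soT ar α (arg ys k))) αY≡))
    ... | ()

    gap-not-below-fun : ∀ {Y} ys {f ns} → PatternAt Y → ¬ (deco α (sgap Y ys) ≼ deco β (sfun f ns))
    gap-not-below-fun {Y} ys pY d≼ with subst (Bool._≤ false) (root-patDeco (α Y) _ (isFun-pattern (α Y) pY))
        (root-mono d≼)
    ... | ()

    module GapCut {Z : Gap} (ns : Vec Sk (proj₂ Z)) (m : Sk) (pZ : PatternAtβ Z) (pat : Patterned m)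
                  (soT≡ : soT ar α m ≡ soT ar β (sgap Z ns)) (deco≼ : deco α m ≼ deco β (sgap Z ns)) where

      τ : ℕ → T
      τ k = soT ar β (arg ns k)

      e : ℕ → Deco
      e k = deco β (arg ns k)

      vars-ℓ : varsT (β Z) ≡ interval 0 (proj₂ Z)
      vars-ℓ = trans (proj₂ pZ) (upTo-interval (proj₂ Z))

      ∈ℓ : ∀ {j} → j < proj₂ Z → j ∈ varsT (β Z)
      ∈ℓ j< = subst (_ ∈_) (sym vars-ℓ) (<⇒∈interval j<)

      hyp : CutHyp m (β Z) τ e
      hyp = trans soT≡ (soT-sgap β Z ns) , subst (deco α m ≼_) (deco-sgap β Z ns) deco≼ , pat ,
            subst Unique (sym vars-ℓ) (interval-unique 0 (proj₂ Z))

      module C = CutSpec (cut-spec m (β Z) τ e hyp)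

      holes-hyp : AllAt (HoleWalkHyp (piece m (β Z))) ns 0
      holes-hyp = allAt _ ns 0 (svar 0) λ j j< →
        subst (HoleWalkHyp (piece m (β Z)) j) (lookupℕ-default ns j (svar j) (svar 0) j<) (C.pieces-ok j (∈ℓ j<))

      valid : ValidImage (Z , cut m (β Z))
      valid = (cut-nonVar m (β Z) (isFun-pattern (β Z) pZ) (proj₁ hyp) , trans C.vars-cut (proj₂ pZ)) , sym C.soT-cut

    mutual
      walk : ∀ γ N m → WalkHyp N m → (Agrees γ (gapImages N m) → soS ar γ N ≡ m) × All ValidImage (gapImages N m)
      walk γ (svar x) m (soT≡ , _ , pat , _) = (λ _ → sym (var-of-soT m pat soT≡)) , []
      walk γ (sfun f ns) (svar x) (() , _)
      walk γ (sfun f ns) (sgap Y ys) (_ , deco≼ , pY ∷ _ , _) = ⊥-elim (gap-not-below-fun ys pY deco≼)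
      walk γ (sfun f ns) (sfun g ms) (soT≡ , node≼ _ ds≼ , pat , patβ) with fun-injectiveˡ soT≡
      ... | refl = Product.map₁ (cong (sfun f) ∘_) (walkArgs γ ns ms (fun-injectiveʳ soT≡ , ds≼ , pat , patβ))
      walk γ (sgap Z ns) m (soT≡ , deco≼ , pat , pZ ∷ patβ) = reassemble , valid ∷ proj₂ W
        where
          open GapCut ns m pZ pat soT≡ deco≼
          W = walkHoles γ ns (piece m (β Z)) 0 (holes-hyp , patβ)
          reassemble : Agrees γ (gapImages (sgap Z ns) m) → soS ar γ (sgap Z ns) ≡ m
          reassemble (γZ≡ ∷ agrees) = begin
            soS ar γ (sgap Z ns)                          ≡⟨ soS-sgap γ Z ns ⟩
            instSk (γ Z) (λ k → soS ar γ (arg ns k))       ≡⟨ cong (λ c → instSk c _) γZ≡ ⟩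
            instSk (cut m (β Z)) (λ k → soS ar γ (arg ns k)) ≡⟨ instSk-ext-vars (cut m (β Z)) pieces≡ ⟩
            instSk (cut m (β Z)) (piece m (β Z))           ≡⟨ C.glue ⟩
            m                                             ∎
            where
              open ≡-Reasoning
              pieces≡ : ∀ i → i ∈ varsOf ar (cut m (β Z)) → soS ar γ (arg ns i) ≡ piece m (β Z) i
              pieces≡ i i∈ = allAt-lookup ns 0 (proj₁ W agrees) i (svar i)
                               (∈interval⇒< (subst (i ∈_) (trans C.vars-cut vars-ℓ) i∈))

      walkArgs : ∀ {n} γ (ns ms : Vec Sk n) → WalkArgsHyp ns ms →
                 (Agrees γ (gapImagesArgs ns (toList ms)) → soSs ar γ ns ≡ ms) ×
                     All ValidImage (gapImagesArgs ns (toList ms))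
      walkArgs γ [] [] _ = (λ _ → refl) , []
      walkArgs γ (N ∷ ns) (m ∷ ms) (soT≡ , ∷≼ _ d≼ ds≼ , pat , patβ) =
        (λ agrees → cong₂ _∷_ (proj₁ W₁ (++⁻ˡ (gapImages N m) agrees)) (proj₁ W₂ (++⁻ʳ (gapImages N m) agrees))) ,
        ++⁺ (proj₂ W₁) (proj₂ W₂)
        where
          W₁ = walk γ N m (∷-injectiveˡ soT≡ , d≼ , ++⁻ˡ (gapsOf ar m) pat , ++⁻ˡ (gapsOf ar N) patβ)
          W₂ = walkArgs γ ns ms (∷-injectiveʳ soT≡ , ds≼ , ++⁻ʳ (gapsOf ar m) pat , ++⁻ʳ (gapsOf ar N) patβ)

      walkHoles : ∀ {n} γ (ns : Vec Sk n) h j0 → WalkHolesHyp ns h j0 →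
                  (Agrees γ (gapImagesHoles ns h j0) → AllAt (λ j N → soS ar γ N ≡ h j) ns j0) ×
                  All ValidImage (gapImagesHoles ns h j0)
      walkHoles γ [] h j0 _ = (λ _ → tt) , []
      walkHoles γ (N ∷ ns) h j0 (((soT≡ , deco≼ , pat) , hyps) , patβ) =
        (λ agrees → proj₁ W₁ (++⁻ˡ (gapImages N (h j0)) agrees) , proj₁ W₂ (++⁻ʳ (gapImages N (h j0)) agrees)) ,
        ++⁺ (proj₂ W₁) (proj₂ W₂)
        where
          W₁ = walk γ N (h j0) (soT≡ , deco≼ , pat , ++⁻ˡ (gapsOf ar N) patβ)
          W₂ = walkHoles γ ns h (suc j0) (hyps , ++⁻ʳ (gapsOf ar N) patβ)

    open CutRenaming α

    mutual
      walk-renaming : ∀ N m → WalkHyp N m → deco β N ≼ deco α m → All RenamingImage (gapImages N m)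
      walk-renaming (svar x) m _ _ = []
      walk-renaming (sfun f ns) (svar x) (() , _)
      walk-renaming (sfun f ns) (sgap Y ys) (_ , deco≼ , pY ∷ _ , _) _ = ⊥-elim (gap-not-below-fun ys pY deco≼)
      walk-renaming (sfun f ns) (sfun g ms) (soT≡ , node≼ _ ds≼ , pat , patβ) (node≼ _ ds≽) with fun-injectiveˡ soT≡
      ... | refl = walkArgs-renaming ns ms (fun-injectiveʳ soT≡ , ds≼ , pat , patβ) ds≽
      walk-renaming (sgap Z ns) m (soT≡ , deco≼ , pat , pZ ∷ patβ) deco≽ =
        proj₁ R ∷ walkHoles-renaming ns (piece m (β Z)) 0 holes-hyp holes-≽ patβ
        where
          open GapCut ns m pZ pat soT≡ deco≼
          R = cut-renaming m (β Z) τ e (proj₂ Z) (isFun-pattern (β Z) pZ) hyp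
                           (subst (_≼ deco α m) (deco-sgap β Z ns) deco≽) vars-ℓ
          holes-≽ : AllAt (λ j N → deco β N ≼ deco α (piece m (β Z) j)) ns 0
          holes-≽ = allAt _ ns 0 (svar 0) λ j j< →
            subst (λ N → deco β N ≼ deco α (piece m (β Z) j)) (lookupℕ-default ns j (svar j) (svar 0) j<)
                (proj₂ R j (∈ℓ j<))

      walkArgs-renaming : ∀ {n} (ns ms : Vec Sk n) → WalkArgsHyp ns ms → decoArgs β ns ≼* decoArgs α ms →
                          All RenamingImage (gapImagesArgs ns (toList ms))
      walkArgs-renaming [] [] _ _ = []
      walkArgs-renaming (N ∷ ns) (m ∷ ms) (soT≡ , ∷≼ _ d≼ ds≼ , pat , patβ) (∷≼ _ d≽ ds≽) = ++⁺
        (walk-renaming N m (∷-injectiveˡ soT≡ , d≼ , ++⁻ˡ (gapsOf ar m) pat , ++⁻ˡ (gapsOf ar N) patβ) d≽)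
        (walkArgs-renaming ns ms (∷-injectiveʳ soT≡ , ds≼ , ++⁻ʳ (gapsOf ar m) pat , ++⁻ʳ (gapsOf ar N) patβ) ds≽)

      walkHoles-renaming : ∀ {n} (ns : Vec Sk n) h j0 → AllAt (HoleWalkHyp h) ns j0 →
                           AllAt (λ j N → deco β N ≼ deco α (h j)) ns j0 → All PatternAtβ (gapsOfs ar ns) →
                           All RenamingImage (gapImagesHoles ns h j0)
      walkHoles-renaming [] h j0 _ _ _ = []
      walkHoles-renaming (N ∷ ns) h j0 ((soT≡ , deco≼ , pat) , hyps) (d≽ , ds≽) patβ = ++⁺
        (walk-renaming N (h j0) (soT≡ , deco≼ , pat , ++⁻ˡ (gapsOf ar N) patβ) d≽)
        (walkHoles-renaming ns h (suc j0) hyps ds≽ (++⁻ʳ (gapsOf ar N) patβ))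

module Refinement {F : Set} (ar : F → ℕ) where

  open import Defs
  open Decorations
  open Prelude
  open GeometricClusters ar
  open ClusterDecorations ar
  open Instantiation ar
  open Cutting ar
  open Walking ar
  open import Data.Nat using (ℕ; zero; suc; _+_; _<_; s≤s; z≤n)
  open import Data.Nat.Properties using (+-suc; +-identityʳ)
  open import Data.Vec using (Vec; []; _∷_)
  open import Data.List using (List; []; _∷_; _++_; map)
  open import Data.List.Properties using (map-++)
  open import Data.List.Membership.Propositional using (_∈_)
  open import Data.List.Membership.Propositional.Properties using (∈-++⁺ˡ; ∈-++⁺ʳ; ∈-map⁻; ∈-map⁺)
  open import Data.List.Relation.Unary.Any using (here; there)
  open import Data.List.Relation.Unary.All as All using (All)
  open import Data.List.Relation.Unary.Unique.Propositional using (Unique)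
  open import Data.Product using (_×_; _,_; proj₁; proj₂)
  open import Relation.Binary.PropositionalEquality using
      (_≡_; refl; sym; trans; cong; cong₂; subst; module ≡-Reasoning)

  mutual
    gapsOf-renS : ∀ ρ M → gapsOf ar (renS ar ρ M) ≡ map (renG ar ρ) (gapsOf ar M)
    gapsOf-renS ρ (svar k) = refl
    gapsOf-renS ρ (sfun f ss) = gapsOfs-renSs ρ ss
    gapsOf-renS ρ (sgap Z ss) = cong (renG ar ρ Z ∷_) (gapsOfs-renSs ρ ss)
    gapsOfs-renSs : ∀ {n} ρ (ss : Vec Sk n) → gapsOfs ar (renSs ar ρ ss) ≡ map (renG ar ρ) (gapsOfs ar ss)
    gapsOfs-renSs ρ [] = refl
    gapsOfs-renSs ρ (s ∷ ss) = trans (cong₂ _++_ (gapsOf-renS ρ s) (gapsOfs-renSs ρ ss))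
        (sym (map-++ (renG ar ρ) (gapsOf ar s) _))

  -- Two inductive clusters M, N of the same term with deco M ≼ deco N: the walk along N
  -- assigns to every gap Z of N the skeleton γ Z cut out of M, and γ N = M.
  module Comparison {M N : Sk} {α β : Gap → T} (icM : IsIndCluster ar (M , α)) (icN : IsIndCluster ar (N , β))
                    (soT≡ : soT ar α M ≡ soT ar β N) (deco≼ : deco α M ≼ deco β N) where

    open Walk α β public

    hyp : WalkHyp N M
    hyp = soT≡ , deco≼ , All.tabulate (IsIndCluster.patterns icM _) , All.tabulate (IsIndCluster.patterns icN _)

    images : List (Gap × Sk)
    images = gapImages N M

    γ : Gap → Sk
    γ = lookupAssoc images

    agrees : Agrees γ images
    agrees = lookupAssoc-agrees images (subst Unique (sym (gapImages-gaps N M)) (IsIndCluster.linear icN))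

    soS-γ : soS ar γ N ≡ M
    soS-γ = proj₁ (walk γ N M hyp) agrees

    image-of : ∀ {Z} → Z ∈ gapsOf ar N → (Z , γ Z) ∈ images
    image-of Z∈ with ∈-map⁻ proj₁ (subst (_ ∈_) (sym (gapImages-gaps N M)) Z∈)
    ... | (Z , g) , Zg∈ , refl = subst (λ h → (Z , h) ∈ images) (sym (All.lookup agrees Zg∈)) Zg∈

    valid : ∀ {Z} → Z ∈ gapsOf ar N → ValidImage (Z , γ Z)
    valid Z∈ = All.lookup (proj₂ (walk γ N M hyp)) (image-of Z∈)

  refinement-of-≼ : ∀ {t} (c c' : IC ar t) → clusterDeco c ≼ clusterDeco c' → _⊒_ ar (proj₁ c') (proj₁ c)
  refinement-of-≼ ((M , α) , icM , refl) ((N , β) , icN , soT≡) deco≼ =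
    γ , (λ Z Z∈ → proj₁ (valid Z∈)) , soS-γ , (λ Z Z∈ → proj₂ (valid Z∈))
    where open Comparison icM icN (sym soT≡) deco≼

  gapName : Sk → ℕ
  gapName (sgap Y _) = proj₁ Y
  gapName _ = 0

  instSks-svars : ∀ {a} (xs : Vec Sk a) j0 (ξ : ℕ → Sk) → (∀ j → j < a → ξ (j0 + j) ≡ lookupℕ xs j (svar 0)) →
      instSks (svars a j0) ξ ≡ xs
  instSks-svars [] j0 ξ h = refl
  instSks-svars (x ∷ xs) j0 ξ h =
    cong₂ _∷_ (trans (cong ξ (sym (+-identityʳ j0))) (h zero (s≤s z≤n)))
              (instSks-svars xs (suc j0) ξ (λ j lt → trans (cong ξ (sym (+-suc j0 j))) (h (suc j) (s≤s lt))))

  lookupℕ-svars : ∀ a j0 k d → k < a → lookupℕ (svars a j0) k d ≡ svar (j0 + k)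
  lookupℕ-svars (suc a) j0 zero d lt = cong svar (sym (+-identityʳ j0))
  lookupℕ-svars (suc a) j0 (suc k) d (s≤s lt) = trans (lookupℕ-svars a (suc j0) k d lt) (cong svar (sym (+-suc j0 k)))

  lookupℕ-renSs : ∀ {n} ρ (ns : Vec Sk n) k d → lookupℕ (renSs ar ρ ns) k (svar d) ≡ renS ar ρ (lookupℕ ns k (svar d))
  lookupℕ-renSs ρ [] k d = refl
  lookupℕ-renSs ρ (x ∷ ns) zero d = refl
  lookupℕ-renSs ρ (x ∷ ns) (suc k) d = lookupℕ-renSs ρ ns k d

  mutual
    soS-renaming : ∀ (γ : Gap → Sk) ρ N → (∀ Z → Z ∈ gapsOf ar N → γ Z ≡ sgap (renG ar ρ Z) (svars (proj₂ Z) 0)) →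
        soS ar γ N ≡ renS ar ρ N
    soS-renaming γ ρ (svar k) h = refl
    soS-renaming γ ρ (sfun f ns) h = cong (sfun f) (soSs-renaming γ ρ ns h)
    soS-renaming γ ρ (sgap Z ns) h =
      trans (soS-sgap γ Z ns)
        (trans (cong (λ z → instSk z (λ k → soS ar γ (arg ns k))) (h Z (here refl)))
          (cong (sgap (renG ar ρ Z)) (instSks-svars (renSs ar ρ ns) 0 _ (λ j lt →
             trans (soS-renaming-lookup γ ρ ns (λ Z' m → h Z' (there m)) j j)
               (trans (sym (lookupℕ-renSs ρ ns j j)) (lookupℕ-default (renSs ar ρ ns) j (svar j) (svar 0) lt))))))
    soSs-renaming : ∀ {n} (γ : Gap → Sk) ρ (ns : Vec Sk n) →
        (∀ Z → Z ∈ gapsOfs ar ns → γ Z ≡ sgap (renG ar ρ Z) (svars (proj₂ Z) 0)) → soSs ar γ ns ≡ renSs ar ρ ns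
    soSs-renaming γ ρ [] h = refl
    soSs-renaming γ ρ (n ∷ ns) h = cong₂ _∷_ (soS-renaming γ ρ n (λ Z m → h Z (∈-++⁺ˡ m)))
        (soSs-renaming γ ρ ns (λ Z m → h Z (∈-++⁺ʳ _ m)))
    soS-renaming-lookup : ∀ {n} (γ : Gap → Sk) ρ (ns : Vec Sk n) →
        (∀ Z → Z ∈ gapsOfs ar ns → γ Z ≡ sgap (renG ar ρ Z) (svars (proj₂ Z) 0)) →
          ∀ k d → soS ar γ (lookupℕ ns k (svar d)) ≡ renS ar ρ (lookupℕ ns k (svar d))
    soS-renaming-lookup γ ρ [] h k d = refl
    soS-renaming-lookup γ ρ (n ∷ ns) h zero d = soS-renaming γ ρ n (λ Z m → h Z (∈-++⁺ˡ m))
    soS-renaming-lookup γ ρ (n ∷ ns) h (suc k) d = soS-renaming-lookup γ ρ ns (λ Z m → h Z (∈-++⁺ʳ _ m)) k d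

  mutual
    inst-identity : ∀ u {σ} → (∀ i → i ∈ varsT u → σ i ≡ var i) → inst u σ ≡ u
    inst-identity (var k) h = h k (here refl)
    inst-identity (fun f us) h = cong (fun f) (insts-identity us h)
    insts-identity : ∀ {n} (us : Vec T n) {σ} → (∀ i → i ∈ varsTs us → σ i ≡ var i) → insts us σ ≡ us
    insts-identity [] h = refl
    insts-identity (u ∷ us) h = cong₂ _∷_ (inst-identity u (λ i m → h i (∈-++⁺ˡ m)))
        (insts-identity us (λ i m → h i (∈-++⁺ʳ _ m)))

  renaming-of-≼-≽ : ∀ {t} (c c' : IC ar t) → clusterDeco c ≼ clusterDeco c' → clusterDeco c' ≼ clusterDeco c →
                    _≈R_ ar (proj₁ c') (proj₁ c)
  renaming-of-≼-≽ ((M , α) , icM , refl) ((N , β) , icN , soT≡) deco≼ deco≽ = ρ , ρ-injective , renS-ρ , α∘ρ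
    where
      open Comparison icM icN (sym soT≡) deco≼

      ρ : ℕ → ℕ → ℕ
      ρ n a = gapName (γ (n , a))

      renamed : ∀ Z → Z ∈ gapsOf ar N → γ Z ≡ sgap (renG ar ρ Z) (svars (proj₂ Z) 0)
      renamed Z Z∈ with All.lookup (walk-renaming N M hyp deco≽) (image-of Z∈)
      ... | y , γZ≡ = trans γZ≡ (cong (λ w → sgap (w , proj₂ Z) (svars (proj₂ Z) 0)) (sym (cong gapName γZ≡)))

      renS-ρ : renS ar ρ N ≡ M
      renS-ρ = trans (sym (soS-renaming γ ρ N renamed)) soS-γ

      gaps-M : gapsOf ar M ≡ map (renG ar ρ) (gapsOf ar N)
      gaps-M = trans (cong (gapsOf ar) (sym renS-ρ)) (gapsOf-renS ρ N)

      ρ-injective : ∀ Z Z' → Z ∈ gapsOf ar N → Z' ∈ gapsOf ar N → renG ar ρ Z ≡ renG ar ρ Z' → Z ≡ Z'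
      ρ-injective Z Z' = unique-map-injective (renG ar ρ) (subst Unique gaps-M (IsIndCluster.linear icM))

      α∘ρ : ∀ Z → Z ∈ gapsOf ar N → α (renG ar ρ Z) ≡ β Z
      α∘ρ Z Z∈ = sym (begin
        β Z                                                   ≡⟨ proj₂ (valid Z∈) ⟩
        soT ar α (γ Z)                                        ≡⟨ cong (soT ar α) (renamed Z Z∈) ⟩
        soT ar α (sgap Y (svars a 0))                         ≡⟨ soT-sgap α Y (svars a 0) ⟩
        inst (α Y) (λ k → soT ar α (arg (svars a 0) k))       ≡⟨ inst-identity (α Y) svars-var ⟩
        α Y                                                   ∎)
        where
          open ≡-Reasoning
          a = proj₂ Z
          Y = renG ar ρ Z
          pY : Pattern ar a (α Y)
          pY = IsIndCluster.patterns icM Y (subst (Y ∈_) (sym gaps-M) (∈-map⁺ (renG ar ρ) Z∈))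
          svars-var : ∀ i → i ∈ varsT (α Y) → soT ar α (arg (svars a 0) i) ≡ var i
          svars-var i i∈ = cong (soT ar α)
            (lookupℕ-svars a 0 i (svar i) (∈interval⇒< (subst (i ∈_) (trans (proj₂ pY) (upTo-interval a)) i∈)))

open Order
open Decorations

module Correspondence {F : Set} (ar : F → ℕ) (t : Term ar) where
  open GeometricClusters ar
  open ClusterDecorations ar
  open CanonicalClusters ar
  open Refinement ar

  clusterDeco-fits : (c : IC ar t) → Fits t (clusterDeco c)
  clusterDeco-fits ((M , α) , _ , refl) = deco-fits α M

  clusterDeco-closed : (c : IC ar t) → Closed (clusterDeco c)
  clusterDeco-closed ((M , α) , _) = deco-closed α M

  clusterDeco-mono : ∀ {c c' : IC ar t} → _⊑I_ ar c c' → clusterDeco c ≼ clusterDeco c'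
  clusterDeco-mono {(M , α) , _} {(N , β) , _} (γ , _ , refl , β≡) = deco-refine-≼ α β γ N β≡

  clusterDeco-cong : ∀ {c c' : IC ar t} → _≈I_ ar c c' → clusterDeco c ≡ clusterDeco c'
  clusterDeco-cong {(M , α) , _} {(N , β) , _} (ρ , _ , refl , β≡) = sym (deco-renS α β ρ M β≡)

  geometric : IC ar t → GC ar t
  geometric c = posOf (clusterDeco c) , geomCluster-posOf t _ (clusterDeco-fits c) (clusterDeco-closed c)

  canonical : GC ar t → IC ar t
  canonical (S , g) = canonicalCluster t (decorate t S) (decorate-fits t S) (decorate-closed t S g)

  geometric-mono : ∀ {c c'} → _⊑I_ ar c c' → _⊆G_ ar (geometric c) (geometric c')
  geometric-mono {c} {c'} c⊑c' = posOf-mono (clusterDeco-mono {c} {c'} c⊑c')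

  geometric-cong : ∀ {c c'} → _≈I_ ar c c' → _≈G_ ar (geometric c) (geometric c')
  geometric-cong {c} {c'} c≈c' = (λ q → subst (λ d → q ∈ₚ d) same) , (λ q → subst (λ d → q ∈ₚ d) (sym same))
    where same = cong posOf (clusterDeco-cong {c} {c'} c≈c')

  ≼-of-geometric : ∀ c c' → _⊆G_ ar (geometric c) (geometric c') → clusterDeco c ≼ clusterDeco c'
  ≼-of-geometric c c' = ≼-of-⊆ t _ _ (clusterDeco-fits c) (clusterDeco-fits c')

  geometric-reflects-⊑ : ∀ {c c'} → _⊆G_ ar (geometric c) (geometric c') → _⊑I_ ar c c'
  geometric-reflects-⊑ {c} {c'} c⊆c' = refinement-of-≼ c c' (≼-of-geometric c c' c⊆c')

  geometric-reflects-≈ : ∀ {c c'} → _≈G_ ar (geometric c) (geometric c') → _≈I_ ar c c'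
  geometric-reflects-≈ {c} {c'} (c⊆c' , c'⊆c) = renaming-of-≼-≽ c' c (≼-of-geometric c' c c'⊆c)
      (≼-of-geometric c c' c⊆c')

  geometric∘canonical : ∀ C → _≈G_ ar (geometric (canonical C)) C
  geometric∘canonical (S , g) = (λ q h → trans (eq q) h) , (λ q h → trans (sym (eq q)) h)
    where
      eq : ∀ q → S q ≡ posOf (clusterDeco (canonical (S , g))) q
      eq q = trans (sym (posOf-decorate t S g q))
                   (cong (λ d → posOf d q)
                       (sym (canonicalCluster-deco t (decorate t S) (decorate-fits t S) (decorate-closed t S g))))

mainTheorem2 : {F : Set} (ar : F → ℕ) (t : Term ar) →
    OrderIso (_≈G_ ar {t}) (_⊆G_ ar {t}) (_≈I_ ar {t}) (_⊑I_ ar {t})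
    × FiniteUpTo (_≈I_ ar {t})
    × Σ (IC ar t → IC ar t → IC ar t) (λ ∨ → Σ (IC ar t → IC ar t → IC ar t) (λ ∧ →
        IsDistributiveLattice (_≈I_ ar {t}) (_⊑I_ ar {t}) ∨ ∧))
    × FiniteUpTo (_≈G_ ar {t})
    × Σ (GC ar t → GC ar t → GC ar t) (λ ∨ → Σ (GC ar t → GC ar t → GC ar t) (λ ∧ →
        IsDistributiveLattice (_≈G_ ar {t}) (_⊆G_ ar {t}) ∨ ∧))
mainTheorem2 ar t =
  orderIso , finite (geomClusters-finite t) , (_ , _ , transportedIsDistributiveLattice isDistributiveLattice) ,
  geomClusters-finite t , (_∪_ , _∩_ , isDistributiveLattice)
  where
    open GeometricClusters ar using (geomCluster-∪; geomCluster-∩; geomClusters-finite)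
    open Correspondence ar t
    open SubsetLattice (GeomCluster ar t) (geomCluster-∪ t) (geomCluster-∩ t)
    open OrderEmbedding isPartialOrder (_≈I_ ar) (_⊑I_ ar) geometric canonical
      (λ {c c'} → geometric-cong {c} {c'}) (λ {c c'} → geometric-reflects-≈ {c} {c'})
      (λ {c c'} → geometric-mono {c} {c'}) (λ {c c'} → geometric-reflects-⊑ {c} {c'}) geometric∘canonical
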